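{- For strictly distinct literals $x,y$ and any $0<p<1$, \[ \Pr\big(x\underset{n}{\rightsquigarrow}\overline x,\ y\underset{n}{\rightsquigarrow}\overline y\big)-\Pr\big(x\underset{n}{\rightsquigarrow}\overline x\big)^2\le\sum_{k\ge1}P_{n,p}(k)\Big(\Pr\big(x\underset{n}{\rightsquigarrow}\overline x\big)-\frac{n-k}{n-1}\Pr\big(x\underset{n-k}{\rightsquigarrow}\overline x\big)\Big). \]
   Context: $F_{n,p}$ is the random 2-SAT formula over $x_1,\dots,x_n$ containing each of the $4\binom n2$ 2-clauses $u\vee v$ ($u\ne v$, $u\ne\overline v$, $u\vee v=v\vee u$) independently with probability $p$; its digraph on the literals has an edge $x\to y$ iff $\overline x\vee y$ is a clause. $x\underset{m}{\rightsquigarrow}\overline x$ denotes the event that in the digraph of $F_{m,p}$ (on $m$ variables, same $p$) there is a directed path from $x$ to $\overline x$. Literals $x,y$ are strictly distinct if $x\ne y$, $x\ne\overline y$. $L^+_{n,p}(x)$ is the set of literals reachable from $x$ in the digraph of $F_{n,p}$ (including $x$); a set of literals is strictly distinct if no two elements are equal or complementary; $P_{n,p}(k)$ is the probability that $L^+_{n,p}(x)$ is strictly distinct with exactly $k$ elements.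
   Formalization: The parameter p takes only rational values with $0<p<1$. -}

module Defs where

open import Data.Nat as ℕ using (ℕ; zero; suc; _∸_; _<ᵇ_)
open import Data.Integer using (+_)
open import Data.Bool using (Bool; true; false; not; _∧_; _∨_; if_then_else_)
open import Data.Fin as Fin using (Fin; toℕ)
open import Data.List using (List; []; _∷_; _++_; map; foldr; concatMap; allFin; length; filter)
open import Data.Bool.ListAction using (any; all)
open import Data.Product using (_×_; _,_; proj₁; proj₂)
open import Relation.Binary.PropositionalEquality using (_≡_; _≢_)
open import Relation.Nullary.Decidable using (⌊_⌋)
open import Data.Rational using (ℚ; 0ℚ; 1ℚ; _+_; _*_; _-_; _/_)

-- A literal over variables x_1..x_n : (variable index , polarity); true = positive.
Lit : ℕ → Set
Lit n = Fin n × Bool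

neg : ∀ {n} → Lit n → Lit n
neg (i , b) = i , not b

StrictlyDistinct : ∀ {n} → Lit n → Lit n → Set
StrictlyDistinct x y = (x ≢ y) × (x ≢ neg y)

_==ᴮ_ : Bool → Bool → Bool
true ==ᴮ true = true
false ==ᴮ false = true
_ ==ᴮ _ = false

_==_ : ∀ {n} → Lit n → Lit n → Bool
(i , a) == (j , b) = ⌊ i Fin.≟ j ⌋ ∧ (a ==ᴮ b)

allLits : ∀ n → List (Lit n)
allLits n = concatMap (λ i → (i , true) ∷ (i , false) ∷ []) (allFin n)

-- A 2-clause u ∨ v (u, v strictly distinct) is stored once, as the pair (u , v)
-- with var u < var v.  There are exactly 4 * (n choose 2) of them.
Clause : ℕ → Set
Clause n = Lit n × Lit n

clauses : ∀ n → List (Clause n)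
clauses n =
  concatMap (λ i → concatMap (λ j →
    if toℕ i <ᵇ toℕ j
    then concatMap (λ a → map (λ b → ((i , a) , (j , b))) (true ∷ false ∷ [])) (true ∷ false ∷ [])
    else []) (allFin n)) (allFin n)

-- A 2-SAT formula on n variables: a subset (sublist) of the clause list.
Formula : ℕ → Set
Formula n = List (Clause n)

sublists : ∀ {A : Set} → List A → List (List A)
sublists [] = [] ∷ []
sublists (c ∷ cs) = map (c ∷_) (sublists cs) ++ sublists cs

hasClause : ∀ {n} → Formula n → Lit n → Lit n → Bool
hasClause F u v = any (λ c → ((proj₁ c == u) ∧ (proj₂ c == v)) ∨ ((proj₁ c == v) ∧ (proj₂ c == u))) F

edge : ∀ {n} → Formula n → Lit n → Lit n → Bool
edge F x y = hasClause F (neg x) y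

walk≤ : ∀ {n} → Formula n → ℕ → Lit n → Lit n → Bool
walk≤ F zero u v = u == v
walk≤ {n} F (suc k) u v = walk≤ F k u v ∨ any (λ w → edge F u w ∧ walk≤ F k w v) (allLits n)

-- directed path from u to v in the digraph of F (the digraph has 2n vertices,
-- so any path has length ≤ 2n)
reach : ∀ {n} → Formula n → Lit n → Lit n → Bool
reach {n} F u v = walk≤ F (2 ℕ.* n) u v

Lplus : ∀ {n} → Formula n → Lit n → List (Lit n)
Lplus {n} F x = filter (λ l → reach F x l Data.Bool.≟ true) (allLits n)
  where import Data.Bool

strictlyDistinctᴮ : ∀ {n} → List (Lit n) → Bool
strictlyDistinctᴮ [] = true
strictlyDistinctᴮ (l ∷ ls) = all (λ m → not (l == m) ∧ not (l == neg m)) ls ∧ strictlyDistinctᴮ ls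

_^ℚ_ : ℚ → ℕ → ℚ
q ^ℚ zero = 1ℚ
q ^ℚ suc k = q * (q ^ℚ k)

sumℚ : List ℚ → ℚ
sumℚ = foldr _+_ 0ℚ

-- a / b as a rational (b = 0 never occurs where used; then returns 0)
ratio : ℕ → ℕ → ℚ
ratio a zero = 0ℚ
ratio a (suc b) = (+ a) / suc b

-- Pr(E) in F_{n,p}: each clause present independently with probability p
Pr : (n : ℕ) → ℚ → (Formula n → Bool) → ℚ
Pr n p E = sumℚ (map (λ F → if E F
                             then (p ^ℚ length F) * ((1ℚ - p) ^ℚ (length (clauses n) ∸ length F))
                             else 0ℚ)
                        (sublists (clauses n)))

PrContra : (n : ℕ) → ℚ → Lit n → ℚ
PrContra n p x = Pr n p (λ F → reach F x (neg x))

-- Pr(x ⇝_m x̄) for F_{m,p}; by symmetry independent of x, taken with x = x_1.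
-- For m = 0 there is no literal; value 0 (it only appears multiplied by 0).
PrContraM : ℕ → ℚ → ℚ
PrContraM zero p = 0ℚ
PrContraM (suc m) p = PrContra (suc m) p (Fin.zero , true)

Pnp : (n : ℕ) → ℚ → Lit n → ℕ → ℚ
Pnp n p x k = Pr n p (λ F → strictlyDistinctᴮ (Lplus F x) ∧ (length (Lplus F x) ℕ.≡ᵇ k))

sumFrom1 : ℕ → (ℕ → ℚ) → ℚ
sumFrom1 zero f = 0ℚ
sumFrom1 (suc n) f = sumFrom1 n f + f (suc n)

-- Write A = Pr(x ⇝ x̄) and W = E[ [L⁺(x) strictly distinct] · (n − |L⁺(x)|)/(n − 1) · Pr(x ⇝_{n−|L⁺(x)|} x̄) ].
-- The right-hand side equals A · Pr(L⁺(x) strictly distinct) − W, and L⁺(x) can only fail to be strictly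
-- distinct when x ⇝ x̄, so it is at least A(1 − A) − W; it therefore suffices that Pr(x ⇝ x̄, y ⇝ ȳ) + W ≤ A.
-- Average over the 2(n − 1) literals y′ whose variable differs from that of x: by symmetry
-- Pr(x ⇝ x̄, y ⇝ ȳ) ≤ Pr(x ⇝ x̄, y′ ⇝ ȳ′) and Pr(y′ ⇝ ȳ′) = A, so it is enough that
-- 2(n − 1) · W ≤ Σ_{y′} Pr(y′ ⇝ ȳ′, x ⇝̸ x̄). Condition on L⁺(x) = S. This event is decided by the clauses
-- touching the variables of S, while for each of the 2(n − |S|) literals y′ over the other variables the
-- clauses avoiding S contain a copy of F_{n−|S|,p}, in which y′ ⇝ ȳ′ has probability Pr(x ⇝_{n−|S|} x̄);
-- the two sets of clauses are independent.
-- F_{n,p} is modelled by 𝔼, the expectation over the random sublist keeping each clause with probability p.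

module Submission where

open import Defs

open import Data.Bool using (Bool; true; false; not; _∧_; _∨_; _xor_; if_then_else_; T)
import Data.Bool as Bool
open import Data.Bool.Properties
  using (T-∧; T-∨; T-≡; T?; ∧-identityʳ; not-involutive; not-¬; not-injective; not-distribʳ-xor)
open import Data.Bool.ListAction using (any; all)
open import Data.Empty using (⊥-elim)
open import Data.Unit using (tt)
open import Data.Product as × using (_×_; _,_; proj₁; proj₂; ∃-syntax)
open import Data.Sum as ⊎ using (_⊎_; inj₁; inj₂)
open import Data.Nat as ℕ using (ℕ; zero; suc; _∸_; z≤n; s≤s)
import Data.Nat.Properties as ℕ
open import Data.Fin as Fin using (Fin; toℕ)
import Data.Fin.Properties as Fin
import Data.Fin.Permutation.Components as Perm
import Data.Integer as ℤ
open import Data.Integer.Tactic.RingSolver using (solve-∀)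
open import Data.Rational using (ℚ; 0ℚ; 1ℚ; _+_; _*_; _-_; -_; _≤_; _<_; toℚᵘ; nonNegative; positive)
open import Data.Rational.Properties as ℚ using (≤-refl; ≤-trans; ≤-reflexive; module ≤-Reasoning)
open import Data.Rational.Solver using (module +-*-Solver)
open import Data.Rational.Unnormalised as ℚᵘ using (mkℚᵘ; *≡*)
import Data.Rational.Unnormalised.Properties as ℚᵘ
open import Data.List using (List; []; _∷_; _++_; [_]; map; length; filter; filterᵇ; allFin; lookup; concatMap)
open import Data.List.Properties using (map-++; map-∘; map-cong; map-cong-local; length-map; length-tabulate)
open import Data.List.Membership.Propositional using (_∈_; find; lose)
open import Data.List.Membership.Propositional.Properties
  using (∈-lookup; ∈-filter⁺; ∈-filter⁻; ∈-map⁺; ∈-map⁻; ∈-allFin; ∈-concatMap⁺; ∈-concatMap⁻; ∈-∃++; ∈-++⁻; ∈-++⁺ˡ; ∈-++⁺ʳ)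
open import Data.List.Relation.Unary.All as All using (All; []; _∷_)
import Data.List.Relation.Unary.All.Properties as All
open import Data.List.Relation.Unary.AllPairs using ([]; _∷_)
open import Data.List.Relation.Unary.Any as Any using (Any; here; there)
open import Data.List.Relation.Unary.Any.Properties using (any⁺; any⁻; lookup-index)
open import Data.List.Relation.Unary.Unique.Propositional using (Unique)
import Data.List.Relation.Unary.Unique.Propositional.Properties as Unique
open import Data.List.Relation.Binary.Disjoint.Propositional using (Disjoint)
open import Data.List.Relation.Binary.Permutation.Propositional as ↭ using (_↭_; ↭-sym)
open import Data.List.Relation.Binary.Permutation.Propositional.Properties using (shift; ∈-resp-↭)
open import Data.List.Relation.Binary.Subset.Propositional using (_⊆_)
open import Data.List.Relation.Binary.Subset.Propositional.Properties using (∷⁺ʳ)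
open import Function using (_∘_; id)
open import Function.Bundles using (_⇔_; mk⇔; module Equivalence)
open import Relation.Binary.Core using (_Preserves_⟶_)
open import Relation.Binary.Definitions using (tri<; tri≈; tri>)
open import Relation.Binary.PropositionalEquality
  using (_≡_; _≢_; refl; sym; trans; cong; cong₂; subst; subst₂; module ≡-Reasoning)
open import Relation.Nullary using (¬_; yes; no; contradiction)
open import Relation.Nullary.Decidable using (⌊_⌋; toWitness; fromWitness)

open Equivalence using (to; from)
open +-*-Solver using (solve; _:=_; _:+_; _:*_; _:-_; con)

private
  variable
    A B : Set
    m n : ℕ

𝟙 : Bool → ℚ
𝟙 true  = 1ℚ
𝟙 false = 0ℚ

𝟙-nonneg : ∀ a → 0ℚ ≤ 𝟙 a
𝟙-nonneg true  = ℚ.<⇒≤ (ℚ.positive⁻¹ 1ℚ)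
𝟙-nonneg false = ≤-refl

𝟙-mono : ∀ {a b} → (T a → T b) → 𝟙 a ≤ 𝟙 b
𝟙-mono {false} {false} _   = ≤-refl
𝟙-mono {false} {true}  _   = 𝟙-nonneg true
𝟙-mono {true}  {true}  _   = ≤-refl
𝟙-mono {true}  {false} a⇒b = ⊥-elim (a⇒b tt)

𝟙-∧ : ∀ a b → 𝟙 a * 𝟙 b ≡ 𝟙 (a ∧ b)
𝟙-∧ true  b = ℚ.*-identityˡ (𝟙 b)
𝟙-∧ false b = ℚ.*-zeroˡ (𝟙 b)

𝟙*-≤ : ∀ c {u v} → 0ℚ ≤ v → (T c → u ≤ v) → 𝟙 c * u ≤ v
𝟙*-≤ true  {u} _   u≤v = ≤-trans (≤-reflexive (ℚ.*-identityˡ u)) (u≤v tt)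
𝟙*-≤ false {u} 0≤v _   = ≤-trans (≤-reflexive (ℚ.*-zeroˡ u)) 0≤v

𝟙*-mono : ∀ c {u v} → (T c → u ≤ v) → 𝟙 c * u ≤ 𝟙 c * v
𝟙*-mono true  {u} {v} u≤v = subst₂ _≤_ (sym (ℚ.*-identityˡ u)) (sym (ℚ.*-identityˡ v)) (u≤v tt)
𝟙*-mono false {u} {v} _   = ≤-reflexive (trans (ℚ.*-zeroˡ u) (sym (ℚ.*-zeroˡ v)))

𝟙*-nonneg : ∀ c {v} → 0ℚ ≤ v → 0ℚ ≤ 𝟙 c * v
𝟙*-nonneg true  {v} 0≤v = ≤-trans 0≤v (≤-reflexive (sym (ℚ.*-identityˡ v)))
𝟙*-nonneg false {v} _   = ≤-reflexive (sym (ℚ.*-zeroˡ v))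

sumℚ-++ : (xs ys : List ℚ) → sumℚ (xs ++ ys) ≡ sumℚ xs + sumℚ ys
sumℚ-++ []       ys = sym (ℚ.+-identityˡ _)
sumℚ-++ (x ∷ xs) ys = trans (cong (x +_) (sumℚ-++ xs ys)) (sym (ℚ.+-assoc x _ _))

sumℚ-+ : (f g : A → ℚ) (xs : List A) → sumℚ (map (λ x → f x + g x) xs) ≡ sumℚ (map f xs) + sumℚ (map g xs)
sumℚ-+ f g []       = sym (ℚ.+-identityˡ 0ℚ)
sumℚ-+ f g (x ∷ xs) rewrite sumℚ-+ f g xs = interchange (f x) (g x) (sumℚ (map f xs)) (sumℚ (map g xs))
  where
  interchange : ∀ a b c d → (a + b) + (c + d) ≡ (a + c) + (b + d)
  interchange = solve 4 (λ a b c d → (a :+ b) :+ (c :+ d) := (a :+ c) :+ (b :+ d)) refl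

sumℚ-*ˡ : (c : ℚ) (f : A → ℚ) (xs : List A) → sumℚ (map (λ x → c * f x) xs) ≡ c * sumℚ (map f xs)
sumℚ-*ˡ c f []       = sym (ℚ.*-zeroʳ c)
sumℚ-*ˡ c f (x ∷ xs) = trans (cong (c * f x +_) (sumℚ-*ˡ c f xs)) (sym (ℚ.*-distribˡ-+ c _ _))

sumℚ-0* : (f : A → ℚ) (xs : List A) → sumℚ (map (λ x → 0ℚ * f x) xs) ≡ 0ℚ
sumℚ-0* f xs = trans (sumℚ-*ˡ 0ℚ f xs) (ℚ.*-zeroˡ (sumℚ (map f xs)))

sumℚ-mono : {f g : A → ℚ} (xs : List A) → (∀ x → f x ≤ g x) → sumℚ (map f xs) ≤ sumℚ (map g xs)
sumℚ-mono []       f≤g = ≤-refl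
sumℚ-mono (x ∷ xs) f≤g = ℚ.+-mono-≤ (f≤g x) (sumℚ-mono xs f≤g)

sumℚ-nonneg : {f : A → ℚ} (xs : List A) → (∀ x → 0ℚ ≤ f x) → 0ℚ ≤ sumℚ (map f xs)
sumℚ-nonneg []       _    = ≤-refl
sumℚ-nonneg (x ∷ xs) 0≤f = ≤-trans (≤-reflexive (sym (ℚ.+-identityˡ 0ℚ))) (ℚ.+-mono-≤ (0≤f x) (sumℚ-nonneg xs 0≤f))

-- Recursive rather than + k / 1, so that sums of indicators evaluate to it directly.
fromℕ : ℕ → ℚ
fromℕ zero    = 0ℚ
fromℕ (suc k) = 1ℚ + fromℕ k

fromℕ-+ : ∀ a b → fromℕ (a ℕ.+ b) ≡ fromℕ a + fromℕ b
fromℕ-+ zero    b = sym (ℚ.+-identityˡ (fromℕ b))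
fromℕ-+ (suc a) b = trans (cong (1ℚ +_) (fromℕ-+ a b)) (sym (ℚ.+-assoc 1ℚ (fromℕ a) (fromℕ b)))

fromℕ-double : ∀ a → fromℕ (2 ℕ.* a) ≡ fromℕ a + fromℕ a
fromℕ-double a = trans (fromℕ-+ a (a ℕ.+ 0)) (cong (λ b → fromℕ a + fromℕ b) (ℕ.+-identityʳ a))

fromℕ-nonneg : ∀ k → 0ℚ ≤ fromℕ k
fromℕ-nonneg zero    = ≤-refl
fromℕ-nonneg (suc k) = ≤-trans (≤-reflexive (sym (ℚ.+-identityˡ 0ℚ))) (ℚ.+-mono-≤ (𝟙-nonneg true) (fromℕ-nonneg k))

fromℕ-positive : ∀ k → 0ℚ < fromℕ (suc k)
fromℕ-positive k = ℚ.<-≤-trans (ℚ.<-respʳ-≡ (ℚ.+-identityʳ 1ℚ) (ℚ.positive⁻¹ 1ℚ)) (ℚ.+-monoʳ-≤ 1ℚ (fromℕ-nonneg k))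

toℚᵘ-fromℕ : ∀ k → toℚᵘ (fromℕ k) ℚᵘ.≃ mkℚᵘ (ℤ.+ k) 0
toℚᵘ-fromℕ zero    = ℚᵘ.≃-refl
toℚᵘ-fromℕ (suc k) = ℚᵘ.≃-trans (ℚ.toℚᵘ-homo-+ 1ℚ (fromℕ k)) (ℚᵘ.≃-trans (ℚᵘ.+-congʳ (toℚᵘ 1ℚ) (toℚᵘ-fromℕ k))
  (*≡* (unit (ℤ.+ k))))
  where
  unit : ∀ k → ((ℤ.+ 1 ℤ.* ℤ.+ 1) ℤ.+ k ℤ.* ℤ.+ 1) ℤ.* ℤ.+ 1 ≡ (ℤ.+ 1 ℤ.+ k) ℤ.* ℤ.+ 1
  unit = solve-∀

ratio*fromℕ : ∀ a d → ratio a (suc d) * fromℕ (suc d) ≡ fromℕ a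
ratio*fromℕ a d = ℚ.toℚᵘ-injective (ℚᵘ.≃-trans (ℚ.toℚᵘ-homo-* (ratio a (suc d)) (fromℕ (suc d)))
  (ℚᵘ.≃-trans (ℚᵘ.*-cong (ℚ.toℚᵘ-fromℚᵘ (mkℚᵘ (ℤ.+ a) d)) (toℚᵘ-fromℕ (suc d)))
    (ℚᵘ.≃-trans (*≡* cross) (ℚᵘ.≃-sym (toℚᵘ-fromℕ a)))))
  where
  cross : ℤ.+ a ℤ.* ℤ.+ suc d ℤ.* ℤ.+ 1 ≡ ℤ.+ a ℤ.* ℤ.+ suc (d ℕ.* 1)
  cross = trans (unit (ℤ.+ a) (ℤ.+ suc d)) (cong (λ z → ℤ.+ a ℤ.* ℤ.+ suc z) (sym (ℕ.*-identityʳ d)))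
    where
    unit : ∀ a s → (a ℤ.* s) ℤ.* ℤ.+ 1 ≡ a ℤ.* s
    unit = solve-∀

fromℕ-double*ratio : ∀ {k d} → k ≡ suc d → ∀ a i m → fromℕ (2 ℕ.* k) * (i * (ratio a k * m)) ≡ i * (fromℕ (2 ℕ.* a) * m)
fromℕ-double*ratio {d = d} refl a i m = begin
    fromℕ (2 ℕ.* suc d) * (i * (ratio a (suc d) * m))
  ≡⟨ cong (_* (i * (ratio a (suc d) * m))) (fromℕ-double (suc d)) ⟩
    (q + q) * (i * (ratio a (suc d) * m))
  ≡⟨ regroup q i (ratio a (suc d)) m ⟩
    i * ((ratio a (suc d) * q + ratio a (suc d) * q) * m)
  ≡⟨ cong (λ z → i * ((z + z) * m)) (ratio*fromℕ a d) ⟩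
    i * ((fromℕ a + fromℕ a) * m)
  ≡⟨ cong (λ z → i * (z * m)) (sym (fromℕ-double a)) ⟩
    i * (fromℕ (2 ℕ.* a) * m) ∎
  where
  open ≡-Reasoning
  q : ℚ
  q = fromℕ (suc d)
  regroup : ∀ q i r m → (q + q) * (i * (r * m)) ≡ i * ((r * q + r * q) * m)
  regroup = solve 4 (λ q i r m → (q :+ q) :* (i :* (r :* m)) := i :* ((r :* q :+ r :* q) :* m)) refl

count : (A → Bool) → List A → ℕ
count P []       = 0
count P (x ∷ xs) = if P x then suc (count P xs) else count P xs

count≤length : (P : A → Bool) (xs : List A) → count P xs ℕ.≤ length xs
count≤length P []       = z≤n
count≤length P (x ∷ xs) with P x
... | true  = s≤s (count≤length P xs)
... | false = ℕ.m≤n⇒m≤1+n (count≤length P xs)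

count-pos : {P : A → Bool} {x : A} {xs : List A} → x ∈ xs → T (P x) → 1 ℕ.≤ count P xs
count-pos {P = P} {xs = y ∷ ys} y∈ Px with P y in Py
... | true  = s≤s z≤n
count-pos {P = P} {xs = y ∷ ys} (here refl)  Px | false = ⊥-elim (subst T Py Px)
count-pos {P = P} {xs = y ∷ ys} (there x∈ys) Px | false = count-pos x∈ys Px

count-none : {P : A → Bool} {xs : List A} → (∀ {x} → x ∈ xs → ¬ T (P x)) → count P xs ≡ 0
count-none {P = P} {[]}     _    = refl
count-none {P = P} {x ∷ xs} none with P x in Px
... | true  = contradiction (T-≡ .from Px) (none (here refl))
... | false = count-none (none ∘ there)

count-cong : {P Q : A → Bool} (xs : List A) → (∀ x → P x ≡ Q x) → count P xs ≡ count Q xs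
count-cong []       P≗Q = refl
count-cong (x ∷ xs) P≗Q rewrite P≗Q x | count-cong xs P≗Q = refl

count-not : (P : A → Bool) (xs : List A) → count (not ∘ P) xs ℕ.+ count P xs ≡ length xs
count-not P []       = refl
count-not P (x ∷ xs) with P x
... | true  = trans (ℕ.+-suc _ _) (cong suc (count-not P xs))
... | false = cong suc (count-not P xs)

count-∨ : {P Q : A → Bool} (xs : List A) → (∀ {x} → x ∈ xs → T (P x) → ¬ T (Q x)) →
          count (λ x → P x ∨ Q x) xs ≡ count P xs ℕ.+ count Q xs
count-∨ []                   _        = refl
count-∨ {P = P} {Q} (x ∷ xs) disjoint with P x in Px | Q x in Qx
... | true  | true  = contradiction (T-≡ .from Qx) (disjoint (here refl) (T-≡ .from Px))
... | true  | false = cong suc (count-∨ xs (disjoint ∘ there))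
... | false | true  = trans (cong suc (count-∨ xs (disjoint ∘ there))) (sym (ℕ.+-suc _ _))
... | false | false = count-∨ xs (disjoint ∘ there)

count-mono : {P Q : A → Bool} → (∀ {x} → T (P x) → T (Q x)) → ∀ xs → count P xs ℕ.≤ count Q xs
count-mono P⇒Q []                = z≤n
count-mono {P = P} {Q} P⇒Q (x ∷ xs) with P x in Px | Q x in Qx
... | true  | true  = s≤s (count-mono P⇒Q xs)
... | true  | false = ⊥-elim (subst T Qx (P⇒Q (T-≡ .from Px)))
... | false | true  = ℕ.m≤n⇒m≤1+n (count-mono P⇒Q xs)
... | false | false = count-mono P⇒Q xs

count-mono-< : {P Q : A → Bool} → (∀ {x} → T (P x) → T (Q x)) →
               ∀ {y xs} → y ∈ xs → T (Q y) → ¬ T (P y) → count P xs ℕ.< count Q xs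
count-mono-< {P = P} {Q} P⇒Q {xs = x ∷ xs} (here refl) Qx ¬Px with P x | Q x
... | true  | _     = contradiction tt ¬Px
... | false | true  = s≤s (count-mono P⇒Q xs)
count-mono-< {P = P} {Q} P⇒Q {xs = x ∷ xs} (there y∈xs) Qy ¬Py with P x in Px | Q x in Qx
... | true  | true  = s≤s (count-mono-< P⇒Q y∈xs Qy ¬Py)
... | true  | false = ⊥-elim (subst T Qx (P⇒Q (T-≡ .from Px)))
... | false | true  = ℕ.m≤n⇒m≤1+n (count-mono-< P⇒Q y∈xs Qy ¬Py)
... | false | false = count-mono-< P⇒Q y∈xs Qy ¬Py

count-≟ : (i : Fin n) {is : List (Fin n)} → Unique is → i ∈ is → count (λ j → ⌊ i Fin.≟ j ⌋) is ≡ 1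
count-≟ i {j ∷ is} (j∉is ∷ _) (here refl) with i Fin.≟ i
... | yes _   = cong suc (count-none λ j∈is i≡j → All.lookup j∉is j∈is (toWitness i≡j))
... | no i≢i  = contradiction refl i≢i
count-≟ i {j ∷ is} (j∉is ∷ is-unique) (there i∈is) with i Fin.≟ j
... | yes refl = contradiction refl (All.lookup j∉is i∈is)
... | no _     = count-≟ i is-unique i∈is

length-filterᵇ : (P : A → Bool) (xs : List A) → length (filterᵇ P xs) ≡ count P xs
length-filterᵇ P []       = refl
length-filterᵇ P (x ∷ xs) with P x
... | true  = cong suc (length-filterᵇ P xs)
... | false = length-filterᵇ P xs

sumℚ-𝟙* : (P : A → Bool) (c : ℚ) (xs : List A) → sumℚ (map (λ x → 𝟙 (P x) * c) xs) ≡ fromℕ (count P xs) * c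
sumℚ-𝟙* P c []       = sym (ℚ.*-zeroˡ c)
sumℚ-𝟙* P c (x ∷ xs) with P x
... | true  = trans (cong (1ℚ * c +_) (sumℚ-𝟙* P c xs)) (sym (ℚ.*-distribʳ-+ c 1ℚ (fromℕ (count P xs))))
... | false = trans (cong₂ _+_ (ℚ.*-zeroˡ c) (sumℚ-𝟙* P c xs)) (ℚ.+-identityˡ _)

sumFrom1-cong : ∀ n {f g : ℕ → ℚ} → (∀ k → f k ≡ g k) → sumFrom1 n f ≡ sumFrom1 n g
sumFrom1-cong zero    f≗g = refl
sumFrom1-cong (suc n) f≗g = cong₂ _+_ (sumFrom1-cong n f≗g) (f≗g (suc n))

sumFrom1-zero : ∀ n {f : ℕ → ℚ} → (∀ {k} → k ℕ.≤ n → f k ≡ 0ℚ) → sumFrom1 n f ≡ 0ℚ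
sumFrom1-zero zero    f≗0 = refl
sumFrom1-zero (suc n) f≗0 = trans (cong₂ _+_ (sumFrom1-zero n (f≗0 ∘ ℕ.m≤n⇒m≤1+n)) (f≗0 ℕ.≤-refl)) (ℚ.+-identityʳ 0ℚ)

private
  𝟙≡ᵇ*-miss : ∀ {j k} (v : ℚ) → j ≢ k → 𝟙 (j ℕ.≡ᵇ k) * v ≡ 0ℚ
  𝟙≡ᵇ*-miss {j} {k} v j≢k with j ℕ.≡ᵇ k in eq
  ... | true  = contradiction (ℕ.≡ᵇ⇒≡ j k (T-≡ .from eq)) j≢k
  ... | false = ℚ.*-zeroˡ v

  𝟙≡ᵇ*-hit : ∀ j (v : ℚ) → 𝟙 (j ℕ.≡ᵇ j) * v ≡ v
  𝟙≡ᵇ*-hit j v rewrite T-≡ .to (ℕ.≡⇒≡ᵇ j j refl) = ℚ.*-identityˡ v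

sumFrom1-delta : ∀ n {j} (g : ℕ → ℚ) → 1 ℕ.≤ j → j ℕ.≤ n → sumFrom1 n (λ k → 𝟙 (j ℕ.≡ᵇ k) * g k) ≡ g j
sumFrom1-delta zero    g (s≤s _) ()
sumFrom1-delta (suc n) {j} g 1≤j j≤1+n with j ℕ.≟ suc n
... | no j≢1+n = trans (cong₂ _+_ (sumFrom1-delta n g 1≤j (ℕ.≤-pred (ℕ.≤∧≢⇒< j≤1+n j≢1+n))) (𝟙≡ᵇ*-miss (g (suc n)) j≢1+n))
                       (ℚ.+-identityʳ (g j))
... | yes refl = trans (cong₂ _+_ (sumFrom1-zero n (λ {k} k≤n → 𝟙≡ᵇ*-miss {j} {k} (g k) (λ { refl → ℕ.n≮n _ k≤n })))
                                  (𝟙≡ᵇ*-hit j (g j)))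
                       (ℚ.+-identityˡ (g j))

bitVectors : ℕ → List (List Bool)
bitVectors zero    = [ [] ]
bitVectors (suc N) = map (true ∷_) (bitVectors N) ++ map (false ∷_) (bitVectors N)

_≡ᵇ_ : List Bool → List Bool → Bool
[]      ≡ᵇ []      = true
(a ∷ w) ≡ᵇ (b ∷ v) = (a ==ᴮ b) ∧ (w ≡ᵇ v)
_       ≡ᵇ _       = false

≡ᵇ⇒≡ : (w v : List Bool) → T (w ≡ᵇ v) → w ≡ v
≡ᵇ⇒≡ []          []          _  = refl
≡ᵇ⇒≡ (true ∷ w)  (true ∷ v)  eq = cong (true ∷_) (≡ᵇ⇒≡ w v eq)
≡ᵇ⇒≡ (false ∷ w) (false ∷ v) eq = cong (false ∷_) (≡ᵇ⇒≡ w v eq)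

≡ᵇ-refl : (w : List Bool) → T (w ≡ᵇ w)
≡ᵇ-refl []          = tt
≡ᵇ-refl (true ∷ w)  = ≡ᵇ-refl w
≡ᵇ-refl (false ∷ w) = ≡ᵇ-refl w

sumℚ-bitVectors-delta : (h : List Bool → ℚ) (w : List Bool) →
                        sumℚ (map (λ b → 𝟙 (w ≡ᵇ b) * h b) (bitVectors (length w))) ≡ h w
sumℚ-bitVectors-delta h []      = trans (ℚ.+-identityʳ _) (ℚ.*-identityˡ (h []))
sumℚ-bitVectors-delta h (a ∷ w) = begin
    sumℚ (map g (map (true ∷_) bs ++ map (false ∷_) bs))
  ≡⟨ trans (cong sumℚ (map-++ g (map (true ∷_) bs) (map (false ∷_) bs))) (sumℚ-++ (map g (map (true ∷_) bs)) _) ⟩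
    sumℚ (map g (map (true ∷_) bs)) + sumℚ (map g (map (false ∷_) bs))
  ≡⟨ cong₂ _+_ (cong sumℚ (sym (map-∘ bs))) (cong sumℚ (sym (map-∘ bs))) ⟩
    sumℚ (map (g ∘ (true ∷_)) bs) + sumℚ (map (g ∘ (false ∷_)) bs)
  ≡⟨ by-head a ⟩
    h (a ∷ w) ∎
  where
  open ≡-Reasoning
  bs = bitVectors (length w)
  g : List Bool → ℚ
  g b = 𝟙 ((a ∷ w) ≡ᵇ b) * h b
  by-head : ∀ a → sumℚ (map (λ b → 𝟙 ((a ∷ w) ≡ᵇ (true ∷ b)) * h (true ∷ b)) bs)
                  + sumℚ (map (λ b → 𝟙 ((a ∷ w) ≡ᵇ (false ∷ b)) * h (false ∷ b)) bs) ≡ h (a ∷ w)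
  by-head true  = trans (cong₂ _+_ (sumℚ-bitVectors-delta (h ∘ (true ∷_)) w) (sumℚ-0* (h ∘ (false ∷_)) bs)) (ℚ.+-identityʳ _)
  by-head false = trans (cong₂ _+_ (sumℚ-0* (h ∘ (true ∷_)) bs) (sumℚ-bitVectors-delta (h ∘ (false ∷_)) w)) (ℚ.+-identityˡ _)

T-not : ∀ {b} → T (not b) ⇔ (¬ T b)
T-not {true}  = mk⇔ (λ ()) (λ ¬b → ¬b tt)
T-not {false} = mk⇔ (λ _ ()) (λ _ → tt)

T-injective : ∀ {a b} → (T a → T b) → (T b → T a) → a ≡ b
T-injective {true}  {true}  _   _   = refl
T-injective {true}  {false} a⇒b _   = ⊥-elim (a⇒b tt)
T-injective {false} {true}  _   b⇒a = ⊥-elim (b⇒a tt)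
T-injective {false} {false} _   _   = refl

∈⇒1≤length : {x : A} {xs : List A} → x ∈ xs → 1 ℕ.≤ length xs
∈⇒1≤length (here _)  = s≤s z≤n
∈⇒1≤length (there _) = s≤s z≤n

filterᵇ-⊆ : (P : A → Bool) (xs : List A) → filterᵇ P xs ⊆ xs
filterᵇ-⊆ P xs = proj₁ ∘ ∈-filter⁻ (T? ∘ P)

concatMap-unique : {f : A → List B} (key : B → A) → (∀ {x y} → y ∈ f x → key y ≡ x) →
                   ∀ {xs} → Unique xs → (∀ x → Unique (f x)) → Unique (concatMap f xs)
concatMap-unique key key-f {[]} _ _ = []
concatMap-unique {f = f} key key-f {x ∷ xs} (x∉xs ∷ xs-unique) f-unique =
  Unique.++⁺ (f-unique x) (concatMap-unique key key-f xs-unique f-unique) disjoint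
  where
  disjoint : Disjoint (f x) (concatMap f xs)
  disjoint (y∈fx , y∈rest) with find (∈-concatMap⁻ f y∈rest)
  ... | x′ , x′∈xs , y∈fx′ = All.lookup x∉xs x′∈xs (trans (sym (key-f y∈fx)) (key-f y∈fx′))

map-unique : (f : A → B) {xs : List A} → (∀ {x y} → x ∈ xs → y ∈ xs → f x ≡ f y → x ≡ y) →
             Unique xs → Unique (map f xs)
map-unique f {[]}     _     []                   = []
map-unique f {x ∷ xs} f-inj (x∉xs ∷ xs-unique) =
  All.map⁺ (All.tabulate x∉) ∷ map-unique f (λ y∈ z∈ → f-inj (there y∈) (there z∈)) xs-unique
  where
  x∉ : ∀ {y} → y ∈ xs → f x ≢ f y
  x∉ y∈xs fx≡fy = All.lookup x∉xs y∈xs (f-inj (here refl) (there y∈xs) fx≡fy)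

lookup-injective : {xs : List A} → Unique xs → ∀ {i j} → lookup xs i ≡ lookup xs j → i ≡ j
lookup-injective {xs = x ∷ xs} _               {Fin.zero}  {Fin.zero}  _  = refl
lookup-injective {xs = x ∷ xs} (x∉xs ∷ _)      {Fin.zero}  {Fin.suc j} eq = contradiction eq (All.lookup x∉xs (∈-lookup j))
lookup-injective {xs = x ∷ xs} (x∉xs ∷ _)      {Fin.suc i} {Fin.zero}  eq = contradiction (sym eq) (All.lookup x∉xs (∈-lookup i))
lookup-injective {xs = x ∷ xs} (_ ∷ xs-unique) {Fin.suc i} {Fin.suc j} eq = cong Fin.suc (lookup-injective xs-unique eq)

sublists-length : (L : List A) → All (λ F → length F ℕ.≤ length L) (sublists L)
sublists-length []       = ℕ.z≤n ∷ []
sublists-length (c ∷ cs) =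
  All.++⁺ (All.map⁺ (All.map ℕ.s≤s (sublists-length cs))) (All.map ℕ.m≤n⇒m≤1+n (sublists-length cs))

select : List Bool → List A → List A
select (true  ∷ bs) (a ∷ as) = a ∷ select bs as
select (false ∷ bs) (a ∷ as) = select bs as
select _            _        = []

filter≡select : (f : A → Bool) (xs : List A) → filter (λ a → f a Bool.≟ true) xs ≡ select (map f xs) xs
filter≡select f []       = refl
filter≡select f (y ∷ ys) with f y
... | true  = cong (y ∷_) (filter≡select f ys)
... | false = filter≡select f ys

-- Random sublists

module Expectation (p : ℚ) where

  mix : ℚ → ℚ → ℚ
  mix a b = p * a + (1ℚ - p) * b

  𝔼 : List A → (List A → ℚ) → ℚ
  𝔼 []       f = f []
  𝔼 (c ∷ cs) f = mix (𝔼 cs (f ∘ (c ∷_))) (𝔼 cs f)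

  private
    weight : List A → List A → ℚ
    weight L F = (p ^ℚ length F) * ((1ℚ - p) ^ℚ (length L ∸ length F))

  𝔼-sublists : (L : List A) (g : List A → ℚ) → sumℚ (map (λ F → g F * weight L F) (sublists L)) ≡ 𝔼 L g
  𝔼-sublists []       g = solve 1 (λ a → a :* (con 1ℚ :* con 1ℚ) :+ con 0ℚ := a) refl (g [])
  𝔼-sublists {A = A} (c ∷ cs) g = begin
      sumℚ (map h (map (c ∷_) S ++ S))
    ≡⟨ cong sumℚ (map-++ h (map (c ∷_) S) S) ⟩
      sumℚ (map h (map (c ∷_) S) ++ map h S)
    ≡⟨ sumℚ-++ (map h (map (c ∷_) S)) (map h S) ⟩
      sumℚ (map h (map (c ∷_) S)) + sumℚ (map h S)
    ≡⟨ cong₂ _+_ (cong sumℚ (trans (sym (map-∘ S)) (map-cong-local (All.tabulate λ {F} _ → kept F))))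
                 (cong sumℚ (map-cong-local (All.map (λ {F} → dropped F) (sublists-length cs)))) ⟩
      sumℚ (map (λ F → p * (g (c ∷ F) * weight cs F)) S) + sumℚ (map (λ F → (1ℚ - p) * (g F * weight cs F)) S)
    ≡⟨ cong₂ _+_ (sumℚ-*ˡ p _ S) (sumℚ-*ˡ (1ℚ - p) _ S) ⟩
      p * sumℚ (map (λ F → g (c ∷ F) * weight cs F) S) + (1ℚ - p) * sumℚ (map (λ F → g F * weight cs F) S)
    ≡⟨ cong₂ mix (𝔼-sublists cs (g ∘ (c ∷_))) (𝔼-sublists cs g) ⟩
      𝔼 (c ∷ cs) g ∎
    where
    open ≡-Reasoning
    S : List (List A)
    S = sublists cs
    h : List A → ℚ
    h F = g F * weight (c ∷ cs) F
    kept : ∀ F → h (c ∷ F) ≡ p * (g (c ∷ F) * weight cs F)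
    kept F = solve 4 (λ a b x y → a :* ((b :* x) :* y) := b :* (a :* (x :* y))) refl
      (g (c ∷ F)) p (p ^ℚ length F) ((1ℚ - p) ^ℚ (length cs ∸ length F))
    dropped : ∀ F → length F ℕ.≤ length cs → h F ≡ (1ℚ - p) * (g F * weight cs F)
    dropped F F≤cs rewrite ℕ.+-∸-assoc 1 F≤cs =
      solve 4 (λ a b x y → a :* (x :* (b :* y)) := b :* (a :* (x :* y))) refl
        (g F) (1ℚ - p) (p ^ℚ length F) ((1ℚ - p) ^ℚ (length cs ∸ length F))

  Pr≡𝔼 : (n : ℕ) (E : Formula n → Bool) → Pr n p E ≡ 𝔼 (clauses n) (𝟙 ∘ E)
  Pr≡𝔼 n E = trans (cong sumℚ (map-cong-local {xs = sublists (clauses n)} (All.tabulate λ {F} _ → if≡𝟙* (E F) _)))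
                   (𝔼-sublists (clauses n) (𝟙 ∘ E))
    where
    if≡𝟙* : ∀ b x → (if b then x else 0ℚ) ≡ 𝟙 b * x
    if≡𝟙* true  x = sym (ℚ.*-identityˡ x)
    if≡𝟙* false x = sym (ℚ.*-zeroˡ x)

  𝔼-cong : (L : List A) {f g : List A → ℚ} → (∀ F → f F ≡ g F) → 𝔼 L f ≡ 𝔼 L g
  𝔼-cong []       f≗g = f≗g []
  𝔼-cong (c ∷ cs) f≗g =
    cong₂ mix (𝔼-cong cs (f≗g ∘ (c ∷_))) (𝔼-cong cs f≗g)

  𝔼-+ : (L : List A) (f g : List A → ℚ) → 𝔼 L (λ F → f F + g F) ≡ 𝔼 L f + 𝔼 L g
  𝔼-+ []       f g = refl
  𝔼-+ (c ∷ cs) f g rewrite 𝔼-+ cs (f ∘ (c ∷_)) (g ∘ (c ∷_)) | 𝔼-+ cs f g =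
    solve 6 (λ a b x y z t → a :* (x :+ y) :+ b :* (z :+ t) := (a :* x :+ b :* z) :+ (a :* y :+ b :* t))
      refl p (1ℚ - p) _ _ _ _

  𝔼-*ˡ : (L : List A) (k : ℚ) (f : List A → ℚ) → 𝔼 L (λ F → k * f F) ≡ k * 𝔼 L f
  𝔼-*ˡ []       k f = refl
  𝔼-*ˡ (c ∷ cs) k f rewrite 𝔼-*ˡ cs k (f ∘ (c ∷_)) | 𝔼-*ˡ cs k f =
    solve 5 (λ a b k x y → a :* (k :* x) :+ b :* (k :* y) := k :* (a :* x :+ b :* y)) refl p (1ℚ - p) k _ _

  𝔼-const : (L : List A) (k : ℚ) → 𝔼 L (λ _ → k) ≡ k
  𝔼-const []       k = refl
  𝔼-const (c ∷ cs) k rewrite 𝔼-const cs k = solve 2 (λ a k → a :* k :+ (con 1ℚ :- a) :* k := k) refl p k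

  𝔼-*ʳ : (L : List A) (k : ℚ) (f : List A → ℚ) → 𝔼 L (λ F → f F * k) ≡ 𝔼 L f * k
  𝔼-*ʳ L k f = trans (𝔼-cong L (λ F → ℚ.*-comm (f F) k)) (trans (𝔼-*ˡ L k f) (ℚ.*-comm k (𝔼 L f)))

  𝔼-map : (φ : A → B) (L : List A) (f : List B → ℚ) → 𝔼 (map φ L) f ≡ 𝔼 L (f ∘ map φ)
  𝔼-map φ []       f = refl
  𝔼-map φ (c ∷ cs) f =
    cong₂ mix (𝔼-map φ cs (f ∘ (φ c ∷_))) (𝔼-map φ cs f)

  𝔼-sumℚ : (L : List A) (bs : List B) (h : B → List A → ℚ) →
           𝔼 L (λ F → sumℚ (map (λ b → h b F) bs)) ≡ sumℚ (map (λ b → 𝔼 L (h b)) bs)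
  𝔼-sumℚ L []       h = 𝔼-const L 0ℚ
  𝔼-sumℚ L (b ∷ bs) h = trans (𝔼-+ L (h b) _) (cong (𝔼 L (h b) +_) (𝔼-sumℚ L bs h))

  𝔼-*-sumℚ : (L : List A) (bs : List B) (e : List A → ℚ) (w : B → ℚ) (c : B → List A → ℚ) →
             𝔼 L (λ F → e F * sumℚ (map (λ b → w b * c b F) bs)) ≡ sumℚ (map (λ b → w b * 𝔼 L (λ F → e F * c b F)) bs)
  𝔼-*-sumℚ L bs e w c = begin
      𝔼 L (λ F → e F * sumℚ (map (λ b → w b * c b F) bs))
    ≡⟨ 𝔼-cong L (λ F → trans (sym (sumℚ-*ˡ (e F) _ bs)) (cong sumℚ (map-cong (λ b → swap (e F) (w b) (c b F)) bs))) ⟩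
      𝔼 L (λ F → sumℚ (map (λ b → w b * (e F * c b F)) bs))
    ≡⟨ 𝔼-sumℚ L bs _ ⟩
      sumℚ (map (λ b → 𝔼 L (λ F → w b * (e F * c b F))) bs)
    ≡⟨ cong sumℚ (map-cong (λ b → 𝔼-*ˡ L (w b) _) bs) ⟩
      sumℚ (map (λ b → w b * 𝔼 L (λ F → e F * c b F)) bs) ∎
    where
    open ≡-Reasoning
    swap : ∀ e w c → e * (w * c) ≡ w * (e * c)
    swap = solve 3 (λ e w c → e :* (w :* c) := w :* (e :* c)) refl

  𝔼-sumFrom1 : (L : List A) (n : ℕ) (h : ℕ → List A → ℚ) →
               𝔼 L (λ F → sumFrom1 n (λ k → h k F)) ≡ sumFrom1 n (λ k → 𝔼 L (h k))
  𝔼-sumFrom1 L zero    h = 𝔼-const L 0ℚ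
  𝔼-sumFrom1 L (suc n) h = trans (𝔼-+ L _ (h (suc n))) (cong (_+ 𝔼 L (h (suc n))) (𝔼-sumFrom1 L n h))

  𝔼-by-key : (L : List A) (N : ℕ) (key : List A → List Bool) → (∀ F → length (key F) ≡ N) →
             (g : List Bool → List A → ℚ) →
             𝔼 L (λ F → g (key F) F) ≡ sumℚ (map (λ b → 𝔼 L (λ F → 𝟙 (key F ≡ᵇ b) * g b F)) (bitVectors N))
  𝔼-by-key L N key length-key g = trans (𝔼-cong L (λ F → sym (split F))) (𝔼-sumℚ L (bitVectors N) _)
    where
    split : ∀ F → sumℚ (map (λ b → 𝟙 (key F ≡ᵇ b) * g b F) (bitVectors N)) ≡ g (key F) F
    split F rewrite sym (length-key F) = sumℚ-bitVectors-delta (λ b → g b F) (key F)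

  𝔼-filter-independent : (P : A → Bool) (L : List A) (f g : List A → ℚ) →
    𝔼 L (λ F → f (filterᵇ P F) * g (filterᵇ (not ∘ P) F)) ≡ 𝔼 (filterᵇ P L) f * 𝔼 (filterᵇ (not ∘ P) L) g
  𝔼-filter-independent P []       f g = refl
  𝔼-filter-independent P (c ∷ cs) f g with P c
  ... | true  rewrite 𝔼-filter-independent P cs (f ∘ (c ∷_)) g | 𝔼-filter-independent P cs f g =
    solve 5 (λ a b x y z → a :* (x :* z) :+ b :* (y :* z) := (a :* x :+ b :* y) :* z) refl
      p (1ℚ - p) (𝔼 (filterᵇ P cs) (f ∘ (c ∷_))) (𝔼 (filterᵇ P cs) f) (𝔼 (filterᵇ (not ∘ P) cs) g)
  ... | false rewrite 𝔼-filter-independent P cs f (g ∘ (c ∷_)) | 𝔼-filter-independent P cs f g =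
    solve 5 (λ a b x y z → a :* (z :* x) :+ b :* (z :* y) := z :* (a :* x :+ b :* y)) refl
      p (1ℚ - p) (𝔼 (filterᵇ (not ∘ P) cs) (g ∘ (c ∷_))) (𝔼 (filterᵇ (not ∘ P) cs) g) (𝔼 (filterᵇ P cs) f)

module Monotonicity (p : ℚ) (0≤p : 0ℚ ≤ p) (p≤1 : p ≤ 1ℚ) where
  open Expectation p

  mix-mono : ∀ {a a′ b b′} → a ≤ a′ → b ≤ b′ → mix a b ≤ mix a′ b′
  mix-mono a≤a′ b≤b′ =
    ℚ.+-mono-≤ (ℚ.*-monoˡ-≤-nonNeg p {{nonNegative 0≤p}} a≤a′) (ℚ.*-monoˡ-≤-nonNeg (1ℚ - p) {{nonNegative 0≤1-p}} b≤b′)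
    where
    0≤1-p : 0ℚ ≤ 1ℚ - p
    0≤1-p = ≤-trans (≤-reflexive (sym (ℚ.+-inverseʳ p))) (ℚ.+-monoˡ-≤ (- p) p≤1)

  𝔼-mono : (L : List A) {f g : List A → ℚ} → (∀ F → f F ≤ g F) → 𝔼 L f ≤ 𝔼 L g
  𝔼-mono []       f≤g = f≤g []
  𝔼-mono (c ∷ cs) f≤g = mix-mono (𝔼-mono cs (f≤g ∘ (c ∷_))) (𝔼-mono cs f≤g)

  𝔼-nonneg : (L : List A) {f : List A → ℚ} → (∀ F → 0ℚ ≤ f F) → 0ℚ ≤ 𝔼 L f
  𝔼-nonneg L 0≤f = ≤-trans (≤-reflexive (sym (𝔼-const L 0ℚ))) (𝔼-mono L 0≤f)

  𝔼-↭ : {f : List A → ℚ} → f Preserves _↭_ ⟶ _≡_ → ∀ {L L′} → L ↭ L′ → 𝔼 L f ≡ 𝔼 L′ f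
  𝔼-↭ inv ↭.refl           = refl
  𝔼-↭ inv (↭.prep c L↭L′)  = cong₂ mix (𝔼-↭ (inv ∘ ↭.prep c) L↭L′) (𝔼-↭ inv L↭L′)
  𝔼-↭ inv (↭.trans L↭ ↭L′) = trans (𝔼-↭ inv L↭) (𝔼-↭ inv ↭L′)
  𝔼-↭ {f = f} inv {x ∷ y ∷ xs} {y ∷ x ∷ ys} (↭.swap x y xs↭ys) = begin
      mix (mix (𝔼 xs (f ∘ (x ∷_) ∘ (y ∷_))) (𝔼 xs (f ∘ (x ∷_)))) (mix (𝔼 xs (f ∘ (y ∷_))) (𝔼 xs f))
    ≡⟨ cong₂ mix (cong₂ mix xy≡yx (𝔼-↭ (inv ∘ ↭.prep x) xs↭ys)) (cong₂ mix (𝔼-↭ (inv ∘ ↭.prep y) xs↭ys) (𝔼-↭ inv xs↭ys)) ⟩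
      mix (mix a b) (mix c d)
    ≡⟨ exchange p (1ℚ - p) a b c d ⟩
      mix (mix a c) (mix b d) ∎
    where
    open ≡-Reasoning
    a b c d : ℚ
    a = 𝔼 ys (f ∘ (y ∷_) ∘ (x ∷_))
    b = 𝔼 ys (f ∘ (x ∷_))
    c = 𝔼 ys (f ∘ (y ∷_))
    d = 𝔼 ys f
    xy≡yx : 𝔼 xs (f ∘ (x ∷_) ∘ (y ∷_)) ≡ a
    xy≡yx = trans (𝔼-↭ (inv ∘ ↭.prep x ∘ ↭.prep y) xs↭ys) (𝔼-cong ys (λ _ → inv (↭.swap x y ↭.refl)))
    exchange : ∀ p q a b c d → p * (p * a + q * b) + q * (p * c + q * d) ≡ p * (p * a + q * c) + q * (p * b + q * d)
    exchange = solve 6 (λ p q a b c d → p :* (p :* a :+ q :* b) :+ q :* (p :* c :+ q :* d)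
                                    := p :* (p :* a :+ q :* c) :+ q :* (p :* b :+ q :* d)) refl

  -- Uniqueness matters: 𝔼 samples repeated entries of a list independently.
  𝔼-⊆ : {f : List A → ℚ} → f Preserves _⊆_ ⟶ _≤_ → ∀ {L₁ L} → Unique L₁ → L₁ ⊆ L → 𝔼 L₁ f ≤ 𝔼 L f
  𝔼-⊆ {f = f} mono {[]} {L} _ _ = begin
      f []
    ≡⟨ sym (𝔼-const L (f [])) ⟩
      𝔼 L (λ _ → f [])
    ≤⟨ 𝔼-mono L (λ _ → mono (λ ())) ⟩
      𝔼 L f ∎
    where open ≤-Reasoning
  𝔼-⊆ {f = f} mono {c ∷ cs} (c∉cs ∷ cs-unique) c∷cs⊆L with ∈-∃++ (c∷cs⊆L (here refl))
  ... | xs , ys , refl = begin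
      𝔼 (c ∷ cs) f
    ≤⟨ mix-mono (𝔼-⊆ (mono ∘ ∷⁺ʳ c) cs-unique cs⊆) (𝔼-⊆ mono cs-unique cs⊆) ⟩
      𝔼 (c ∷ xs ++ ys) f
    ≡⟨ 𝔼-↭ invariant (↭-sym (shift c xs ys)) ⟩
      𝔼 (xs ++ [ c ] ++ ys) f ∎
    where
    open ≤-Reasoning
    invariant : f Preserves _↭_ ⟶ _≡_
    invariant F↭G = ℚ.≤-antisym (mono (∈-resp-↭ F↭G)) (mono (∈-resp-↭ (↭-sym F↭G)))
    cs⊆ : cs ⊆ xs ++ ys
    cs⊆ {d} d∈cs with ∈-++⁻ xs (c∷cs⊆L (there d∈cs))
    ... | inj₁ d∈xs          = ∈-++⁺ˡ d∈xs
    ... | inj₂ (here refl)   = contradiction refl (All.lookup c∉cs d∈cs)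
    ... | inj₂ (there d∈ys)  = ∈-++⁺ʳ xs d∈ys

-- Literals and the implication digraph

==⇒≡ : (l l′ : Lit n) → T (l == l′) → l ≡ l′
==⇒≡ (i , a) (j , b) eq with i Fin.≟ j
==⇒≡ (i , true)  (.i , true)  _  | yes refl = refl
==⇒≡ (i , false) (.i , false) _  | yes refl = refl
==⇒≡ (i , a)     (j , b)      () | no _

==-refl : (l : Lit n) → T (l == l)
==-refl (i , a) with i Fin.≟ i
==-refl (i , true)  | yes _ = tt
==-refl (i , false) | yes _ = tt
... | no i≢i = contradiction refl i≢i

neg-involutive : (l : Lit n) → neg (neg l) ≡ l
neg-involutive (i , a) = cong (i ,_) (not-involutive a)

var : Lit n → Fin n
var = proj₁

same-var : (l l′ : Lit n) → var l′ ≡ var l → l′ ≡ l ⊎ l′ ≡ neg l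
same-var (i , true)  (.i , true)  refl = inj₁ refl
same-var (i , true)  (.i , false) refl = inj₂ refl
same-var (i , false) (.i , true)  refl = inj₂ refl
same-var (i , false) (.i , false) refl = inj₁ refl

∈-allLits : (l : Lit n) → l ∈ allLits n
∈-allLits (i , a) = ∈-concatMap⁺ (λ j → (j , true) ∷ (j , false) ∷ []) (Any.map (λ { refl → polarity a }) (∈-allFin i))
  where
  polarity : ∀ a → (i , a) ∈ (i , true) ∷ (i , false) ∷ []
  polarity true  = here refl
  polarity false = there (here refl)

length-allFin : ∀ n → length (allFin n) ≡ n
length-allFin n = length-tabulate {n = n} id

length-allLits : ∀ n → length (allLits n) ≡ 2 ℕ.* n
length-allLits n = trans (length-pairs (allFin n)) (cong (2 ℕ.*_) (length-allFin n))
  where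
  length-pairs : (is : List (Fin n)) → length (concatMap (λ i → (i , true) ∷ (i , false) ∷ []) is) ≡ 2 ℕ.* length is
  length-pairs []       = refl
  length-pairs (i ∷ is) = trans (cong (suc ∘ suc) (length-pairs is)) (sym (ℕ.*-suc 2 (length is)))

allLits-unique : ∀ n → Unique (allLits n)
allLits-unique n = concatMap-unique var var-pair (Unique.allFin⁺ n) (λ i → ((λ ()) ∷ []) ∷ [] ∷ [])
  where
  var-pair : ∀ {i} {l : Lit n} → l ∈ (i , true) ∷ (i , false) ∷ [] → var l ≡ i
  var-pair (here refl)         = refl
  var-pair (there (here refl)) = refl

count-vars : (Q : Fin n → Bool) → count (Q ∘ var) (allLits n) ≡ 2 ℕ.* count Q (allFin n)
count-vars {n} Q = go (allFin n)
  where
  go : (is : List (Fin n)) → count (Q ∘ var) (concatMap (λ i → (i , true) ∷ (i , false) ∷ []) is) ≡ 2 ℕ.* count Q is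
  go []       = refl
  go (i ∷ is) with Q i
  ... | true  = trans (cong (suc ∘ suc) (go is)) (sym (ℕ.*-suc 2 _))
  ... | false = go is

==-pair⇒≡ : (c : Clause n) {a b : Lit n} → T ((proj₁ c == a) ∧ (proj₂ c == b)) → c ≡ (a , b)
==-pair⇒≡ (c₁ , c₂) {a} {b} matches with T-∧ {c₁ == a} .to matches
... | c₁≡a , c₂≡b = cong₂ _,_ (==⇒≡ c₁ a c₁≡a) (==⇒≡ c₂ b c₂≡b)

hasClause⁺ : (F : Formula n) {a b : Lit n} → (a , b) ∈ F ⊎ (b , a) ∈ F → T (hasClause F a b)
hasClause⁺ F {a} {b} (inj₁ ab∈F) = any⁺ _ (Any.map (λ { refl → T-∨ .from (inj₁ (T-∧ .from (==-refl a , ==-refl b))) }) ab∈F)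
hasClause⁺ F {a} {b} (inj₂ ba∈F) = any⁺ _ (Any.map (λ { refl → T-∨ .from (inj₂ (T-∧ .from (==-refl b , ==-refl a))) }) ba∈F)

hasClause⁻ : (F : Formula n) {a b : Lit n} → T (hasClause F a b) → (a , b) ∈ F ⊎ (b , a) ∈ F
hasClause⁻ F h with find (any⁻ _ F h)
... | c , c∈F , matches with T-∨ .to matches
...   | inj₁ ab = inj₁ (subst (_∈ F) (==-pair⇒≡ c ab) c∈F)
...   | inj₂ ba = inj₂ (subst (_∈ F) (==-pair⇒≡ c ba) c∈F)

hasClause-sym : (F : Formula n) {u v : Lit n} → T (hasClause F u v) → T (hasClause F v u)
hasClause-sym F = hasClause⁺ F ∘ ⊎.swap ∘ hasClause⁻ F

edge-dual : (F : Formula n) {u w : Lit n} → T (edge F u w) → T (edge F (neg w) (neg u))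
edge-dual F {u} {w} uw = subst (λ z → T (hasClause F z (neg u))) (sym (neg-involutive w)) (hasClause-sym F uw)

edge-⊆ : {F G : Formula n} {u w : Lit n} → F ⊆ G → T (edge F u w) → T (edge G u w)
edge-⊆ {F = F} {G} F⊆G = hasClause⁺ G ∘ ⊎.map F⊆G F⊆G ∘ hasClause⁻ F

module Walks {n : ℕ} (F : Formula n) where

  walk-zero⁻ : {u v : Lit n} → T (walk≤ F 0 u v) → u ≡ v
  walk-zero⁻ = ==⇒≡ _ _

  walk-suc : ∀ k {u v} → T (walk≤ F k u v) → T (walk≤ F (suc k) u v)
  walk-suc k uv = T-∨ .from (inj₁ uv)

  walk-cons : ∀ k {u w v} → T (edge F u w) → T (walk≤ F k w v) → T (walk≤ F (suc k) u v)
  walk-cons k {w = w} uw wv = T-∨ .from (inj₂ (any⁺ _ (lose (∈-allLits w) (T-∧ .from (uw , wv)))))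

  walk-suc⁻ : ∀ k {u v} → T (walk≤ F (suc k) u v) →
              T (walk≤ F k u v) ⊎ ∃[ w ] T (edge F u w) × T (walk≤ F k w v)
  walk-suc⁻ k {u} uv with T-∨ .to uv
  ... | inj₁ short = inj₁ short
  ... | inj₂ step with find (any⁻ _ (allLits n) step)
  ...   | w , _ , uwv = inj₂ (w , T-∧ .to uwv)

  walk-refl : ∀ k {u} → T (walk≤ F k u u)
  walk-refl zero    {u} = ==-refl u
  walk-refl (suc k)     = walk-suc k (walk-refl k)

  walk-snoc : ∀ k {u w v} → T (walk≤ F k u w) → T (edge F w v) → T (walk≤ F (suc k) u v)
  walk-snoc zero {u} {w} {v} uw wv with refl ← walk-zero⁻ {u} {w} uw = walk-cons 0 wv (walk-refl 0 {v})
  walk-snoc (suc k) uw wv with walk-suc⁻ k uw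
  ... | inj₁ short            = walk-suc (suc k) (walk-snoc k short wv)
  ... | inj₂ (z , uz , zw)    = walk-cons (suc k) uz (walk-snoc k zw wv)

  walk-snoc⁻ : ∀ k {u v} → T (walk≤ F (suc k) u v) →
               T (walk≤ F k u v) ⊎ ∃[ w ] T (walk≤ F k u w) × T (edge F w v)
  walk-snoc⁻ k uv with walk-suc⁻ k uv
  ... | inj₁ short         = inj₁ short
  ... | inj₂ (z , uz , zv) = last k uz zv
    where
    last : ∀ k {u z v} → T (edge F u z) → T (walk≤ F k z v) →
           T (walk≤ F k u v) ⊎ ∃[ w ] T (walk≤ F k u w) × T (edge F w v)
    last zero {u} {z} {v} uz zv with refl ← walk-zero⁻ {z} {v} zv = inj₂ (u , walk-refl 0 {u} , uz)
    last (suc k) uz zv with walk-snoc⁻ k zv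
    ... | inj₁ short          = inj₁ (walk-cons k uz short)
    ... | inj₂ (w , zw , wv)  = inj₂ (w , walk-cons k uz zw , wv)

  walk-++ : ∀ a b {u w v} → T (walk≤ F a u w) → T (walk≤ F b w v) → T (walk≤ F (a ℕ.+ b) u v)
  walk-++ zero b {u} {w} uw wv with refl ← walk-zero⁻ {u} {w} uw = wv
  walk-++ (suc a) b uw wv with walk-suc⁻ a uw
  ... | inj₁ short         = walk-suc (a ℕ.+ b) (walk-++ a b short wv)
  ... | inj₂ (z , uz , zw) = walk-cons (a ℕ.+ b) uz (walk-++ a b zw wv)

  walk-mono : ∀ {k k′ u v} → k ℕ.≤ k′ → T (walk≤ F k u v) → T (walk≤ F k′ u v)
  walk-mono {u = u} {v} = go ∘ ℕ.≤⇒≤′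
    where
    go : ∀ {k k′} → k ℕ.≤′ k′ → T (walk≤ F k u v) → T (walk≤ F k′ u v)
    go ℕ.≤′-refl                 uv = uv
    go (ℕ.≤′-step {k′} k≤k′) uv = walk-suc k′ (go k≤k′ uv)

  walk-dual : ∀ k {u v} → T (walk≤ F k u v) → T (walk≤ F k (neg v) (neg u))
  walk-dual zero {u} {v} uv with refl ← walk-zero⁻ {u} {v} uv = ==-refl (neg u)
  walk-dual (suc k) uv with walk-suc⁻ k uv
  ... | inj₁ short         = walk-suc k (walk-dual k short)
  ... | inj₂ (w , uw , wv) = walk-snoc k (walk-dual k wv) (edge-dual F uw)

walk-map : {F : Formula m} {G : Formula n} (σ : Lit m → Lit n) →
           (∀ {u w} → T (edge F u w) → T (edge G (σ u) (σ w))) →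
           ∀ k {u v} → T (walk≤ F k u v) → T (walk≤ G k (σ u) (σ v))
walk-map {F = F} {G} σ σ-edge zero {u} {v} uv with refl ← Walks.walk-zero⁻ F {u} {v} uv = ==-refl (σ u)
walk-map {F = F} {G} σ σ-edge (suc k) uv with Walks.walk-suc⁻ F k uv
... | inj₁ short         = Walks.walk-suc G k (walk-map σ σ-edge k short)
... | inj₂ (w , uw , wv) = Walks.walk-cons G k (σ-edge uw) (walk-map σ σ-edge k wv)

walk-⊆ : {F G : Formula n} → F ⊆ G → ∀ k {u v} → T (walk≤ F k u v) → T (walk≤ G k u v)
walk-⊆ {F = F} {G} F⊆G = walk-map id (edge-⊆ {F = F} {G} F⊆G)

walk-restrict : {F G : Formula n} {x : Lit n} → ∀ k →
                (∀ {u w} → T (walk≤ G k x u) → T (edge F u w) → T (edge G u w)) →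
                ∀ {l} → T (walk≤ F k x l) → T (walk≤ G k x l)
walk-restrict zero    _      xl = xl
walk-restrict {F = F} {G} {x} (suc k) closed xl with Walks.walk-snoc⁻ F k xl
... | inj₁ short = Walks.walk-suc G k (walk-restrict k (closed ∘ Walks.walk-suc G k) short)
... | inj₂ (w , xw , wl) = Walks.walk-snoc G k xwᴳ (closed (Walks.walk-suc G k xwᴳ) wl)
  where
  xwᴳ : T (walk≤ G k x w)
  xwᴳ = walk-restrict k (closed ∘ Walks.walk-suc G k) xw

-- The sets of literals reachable in at most j steps grow strictly until they stabilise,
-- and there are only 2n literals.
module Saturation {n : ℕ} (F : Formula n) (u : Lit n) where
  open Walks F

  private
    R : ℕ → Lit n → Bool
    R j = walk≤ F j u

    Stable : ℕ → Set
    Stable j = ∀ {v} → T (R (suc j) v) → T (R j v)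

    stable-forever : ∀ {j} → Stable j → ∀ i {v} → T (R (i ℕ.+ j) v) → T (R j v)
    stable-forever st zero    uv = uv
    stable-forever {j} st (suc i) uv with walk-snoc⁻ (i ℕ.+ j) uv
    ... | inj₁ short         = stable-forever st i short
    ... | inj₂ (w , uw , wv) = st (walk-snoc j (stable-forever st i uw) wv)

    stable-or-growing : ∀ j → (∃[ i ] i ℕ.≤ j × Stable i) ⊎ suc j ℕ.≤ count (R j) (allLits n)
    stable-or-growing zero = inj₂ (count-pos (∈-allLits u) (walk-refl 0 {u}))
    stable-or-growing (suc j) with stable-or-growing j
    ... | inj₁ (i , i≤j , st) = inj₁ (i , ℕ.m≤n⇒m≤1+n i≤j , st)
    ... | inj₂ growing with Any.any? (λ v → T? (R (suc j) v ∧ not (R j v))) (allLits n)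
    ...   | no none = inj₁ (j , ℕ.n≤1+n j , stable)
      where
      stable : Stable j
      stable {v} uv with T? (R j v)
      ... | yes short = short
      ... | no ¬short = contradiction (lose (∈-allLits v) (T-∧ .from (uv , T-not .from ¬short))) none
    ...   | yes new with find new
    ...     | v , v∈ , new-v with T-∧ .to new-v
    ...       | uv , ¬uv = inj₂ (ℕ.≤-trans (s≤s growing) (count-mono-< (walk-suc j) v∈ uv (T-not .to ¬uv)))

  reach-saturated : ∀ k {v} → T (walk≤ F k u v) → T (reach F u v)
  reach-saturated k {v} uv with stable-or-growing (2 ℕ.* n)
  ... | inj₂ growing = contradiction (ℕ.≤-trans growing (ℕ.≤-trans (count≤length (R (2 ℕ.* n)) (allLits n)) (ℕ.≤-reflexive (length-allLits n)))) (ℕ.n≮n _)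
  ... | inj₁ (i , i≤2n , st) with ℕ.≤-total k i
  ...   | inj₁ k≤i = walk-mono (ℕ.≤-trans k≤i i≤2n) uv
  ...   | inj₂ i≤k = walk-mono i≤2n (stable-forever st (k ∸ i) (subst (λ z → T (walk≤ F z u v)) (sym (ℕ.m∸n+n≡m i≤k)) uv))

contra : Formula n → Lit n → Bool
contra F u = reach F u (neg u)

Increasing : (Formula n → Bool) → Set
Increasing E = ∀ {F G} → F ⊆ G → T (E F) → T (E G)

reach-increasing : (u v : Lit n) → Increasing (λ F → reach F u v)
reach-increasing {n} u v F⊆G = walk-⊆ F⊆G (2 ℕ.* n)

∧-increasing : {E E′ : Formula n → Bool} → Increasing E → Increasing E′ → Increasing (λ F → E F ∧ E′ F)
∧-increasing {E = E} inc inc′ F⊆G EF∧E′F with T-∧ {E _} .to EF∧E′F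
... | EF , E′F = T-∧ .from (inc F⊆G EF , inc′ F⊆G E′F)

module _ {n : ℕ} where
  private
    pairsAt : Fin n → Fin n → List (Clause n)
    pairsAt i j = concatMap (λ a → map (λ b → ((i , a) , (j , b))) (true ∷ false ∷ [])) (true ∷ false ∷ [])

    row : Fin n → List (Clause n)
    row i = concatMap (λ j → if toℕ i ℕ.<ᵇ toℕ j then pairsAt i j else []) (allFin n)

    ∈-pairsAt : ∀ {i j} a b → ((i , a) , (j , b)) ∈ pairsAt i j
    ∈-pairsAt true  true  = here refl
    ∈-pairsAt true  false = there (here refl)
    ∈-pairsAt false true  = there (there (here refl))
    ∈-pairsAt false false = there (there (there (here refl)))

    pairsAt-vars : ∀ {i j c} → c ∈ pairsAt i j → var (proj₁ c) ≡ i × var (proj₂ c) ≡ j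
    pairsAt-vars (here refl)                         = refl , refl
    pairsAt-vars (there (here refl))                 = refl , refl
    pairsAt-vars (there (there (here refl)))         = refl , refl
    pairsAt-vars (there (there (there (here refl)))) = refl , refl

    pairsAt-unique : ∀ i j → Unique (pairsAt i j)
    pairsAt-unique i j = ((λ ()) ∷ (λ ()) ∷ (λ ()) ∷ []) ∷ ((λ ()) ∷ (λ ()) ∷ []) ∷ ((λ ()) ∷ []) ∷ [] ∷ []

    ∈-if⁺ : ∀ {b} {x : A} {xs} → T b → x ∈ xs → x ∈ (if b then xs else [])
    ∈-if⁺ {b = true} _ x∈xs = x∈xs

    ∈-if⁻ : ∀ b {x : A} {xs} → x ∈ (if b then xs else []) → T b × x ∈ xs
    ∈-if⁻ true x∈xs = tt , x∈xs

    if-unique : ∀ b {xs : List A} → Unique xs → Unique (if b then xs else [])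
    if-unique true  xs-unique = xs-unique
    if-unique false _         = []

    ∈-row⁻ : ∀ {i c} → c ∈ row i → ∃[ j ] T (toℕ i ℕ.<ᵇ toℕ j) × c ∈ pairsAt i j
    ∈-row⁻ {i} c∈row with find (∈-concatMap⁻ _ {allFin n} c∈row)
    ... | j , _ , c∈ = j , ∈-if⁻ (toℕ i ℕ.<ᵇ toℕ j) c∈

  ∈-clauses⁺ : ∀ {i j : Fin n} a b → i Fin.< j → ((i , a) , (j , b)) ∈ clauses n
  ∈-clauses⁺ {i} {j} a b i<j =
    ∈-concatMap⁺ row (lose (∈-allFin i) (∈-concatMap⁺ _ (lose (∈-allFin j) (∈-if⁺ (ℕ.<⇒<ᵇ i<j) (∈-pairsAt a b)))))

  ∈-clauses⁻ : ∀ {c} → c ∈ clauses n → var (proj₁ c) Fin.< var (proj₂ c)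
  ∈-clauses⁻ c∈ with find (∈-concatMap⁻ row {allFin n} c∈)
  ... | i , _ , c∈row with ∈-row⁻ c∈row
  ...   | j , i<j , c∈pairs with pairsAt-vars c∈pairs
  ...     | refl , refl = ℕ.<ᵇ⇒< _ _ i<j

  clauses-unique : Unique (clauses n)
  clauses-unique = concatMap-unique (var ∘ proj₁) (λ c∈row → proj₁ (pairsAt-vars (proj₂ (proj₂ (∈-row⁻ c∈row)))))
    (Unique.allFin⁺ n)
    (λ i → concatMap-unique (var ∘ proj₂) (λ {j} c∈ → proj₂ (pairsAt-vars (proj₂ (∈-if⁻ (toℕ i ℕ.<ᵇ toℕ j) c∈))))
             (Unique.allFin⁺ n) (λ j → if-unique (toℕ i ℕ.<ᵇ toℕ j) (pairsAt-unique i j)))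

-- clauses n lists each clause with its smaller variable first; orient puts a pair of literals in that form.
orient : Lit n → Lit n → Clause n
orient a b with Fin.<-cmp (var a) (var b)
... | tri< _ _ _ = a , b
... | tri≈ _ _ _ = b , a
... | tri> _ _ _ = b , a

orient-cases : (a b : Lit n) → orient a b ≡ (a , b) ⊎ orient a b ≡ (b , a)
orient-cases a b with Fin.<-cmp (var a) (var b)
... | tri< _ _ _ = inj₁ refl
... | tri≈ _ _ _ = inj₂ refl
... | tri> _ _ _ = inj₂ refl

orient-∈-clauses : (a b : Lit n) → var a ≢ var b → orient a b ∈ clauses n
orient-∈-clauses a b a≢b with Fin.<-cmp (var a) (var b)
... | tri< a<b _ _ = ∈-clauses⁺ _ _ a<b
... | tri≈ _ a≡b _ = contradiction a≡b a≢b
... | tri> _ _ b<a = ∈-clauses⁺ _ _ b<a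

orient-∈ : {F : Formula n} (a b : Lit n) → orient a b ∈ F → (a , b) ∈ F ⊎ (b , a) ∈ F
orient-∈ {F = F} a b ab∈F with orient-cases a b
... | inj₁ eq = inj₁ (subst (_∈ F) eq ab∈F)
... | inj₂ eq = inj₂ (subst (_∈ F) eq ab∈F)

orient-injective : {a b a′ b′ : Lit n} → orient a b ≡ orient a′ b′ → (a , b) ≡ (a′ , b′) ⊎ (a , b) ≡ (b′ , a′)
orient-injective {a = a} {b} {a′} {b′} eq with orient-cases a b | orient-cases a′ b′
... | inj₁ e | inj₁ e′ = inj₁ (trans (sym e) (trans eq e′))
... | inj₁ e | inj₂ e′ = inj₂ (trans (sym e) (trans eq e′))
... | inj₂ e | inj₁ e′ = inj₂ (cong ×.swap (trans (sym e) (trans eq e′)))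
... | inj₂ e | inj₂ e′ = inj₁ (cong ×.swap (trans (sym e) (trans eq e′)))

record LitEmbedding (m n : ℕ) : Set where
  field
    ι           : Fin m → Fin n
    ι-injective : ∀ {i j} → ι i ≡ ι j → i ≡ j
    flips       : Fin m → Bool

  lit : Lit m → Lit n
  lit (i , s) = ι i , flips i xor s

  lit-neg : (l : Lit m) → lit (neg l) ≡ neg (lit l)
  lit-neg (i , s) = cong (ι i ,_) (sym (not-distribʳ-xor (flips i) s))

  lit-injective : ∀ {l l′} → lit l ≡ lit l′ → l ≡ l′
  lit-injective {i , s} {j , t} eq with refl ← ι-injective (cong proj₁ eq) =
    cong (i ,_) (xor-injective (flips i) (cong proj₂ eq))
    where
    xor-injective : ∀ φ {s t} → φ xor s ≡ φ xor t → s ≡ t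
    xor-injective true  = not-injective
    xor-injective false = id

  clause : Clause m → Clause n
  clause (a , b) = orient (lit a) (lit b)

  clause-∈ : ∀ {c} → c ∈ clauses m → clause c ∈ clauses n
  clause-∈ {a , b} c∈ = orient-∈-clauses (lit a) (lit b) (Fin.<⇒≢ (∈-clauses⁻ c∈) ∘ ι-injective)

  clause-injective : ∀ {c c′} → c ∈ clauses m → c′ ∈ clauses m → clause c ≡ clause c′ → c ≡ c′
  clause-injective {a , b} {a′ , b′} c∈ c′∈ eq with orient-injective eq
  ... | inj₁ same = cong₂ _,_ (lit-injective (cong proj₁ same)) (lit-injective (cong proj₂ same))
  ... | inj₂ swapped with refl ← lit-injective (cong proj₁ swapped) | refl ← lit-injective (cong proj₂ swapped) =
    contradiction (∈-clauses⁻ c′∈) (Fin.<-asym (∈-clauses⁻ c∈))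

  image-unique : Unique (map clause (clauses m))
  image-unique = map-unique clause clause-injective clauses-unique

  edge-map : {F : Formula m} {u w : Lit m} → T (edge F u w) → T (edge (map clause F) (lit u) (lit w))
  edge-map {F} {u} {w} uw = subst (λ z → T (hasClause (map clause F) z (lit w))) (lit-neg u) (image (hasClause⁻ F uw))
    where
    G : Formula n
    G = map clause F
    image : (neg u , w) ∈ F ⊎ (w , neg u) ∈ F → T (hasClause G (lit (neg u)) (lit w))
    image (inj₁ c∈F) = hasClause⁺ G (orient-∈ _ _ (∈-map⁺ clause c∈F))
    image (inj₂ c∈F) = hasClause-sym G (hasClause⁺ G (orient-∈ _ _ (∈-map⁺ clause c∈F)))

  walk-image : {F : Formula m} → ∀ k {u v} → T (walk≤ F k u v) → T (walk≤ (map clause F) k (lit u) (lit v))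
  walk-image {F = F} = walk-map {F = F} {G = map clause F} lit (λ {u} {w} → edge-map {F} {u} {w})

  image-⊆ : map clause (clauses m) ⊆ clauses n
  image-⊆ c∈ with ∈-map⁻ clause c∈
  ... | c₀ , c₀∈ , refl = clause-∈ c₀∈

  reach-image : {F : Formula m} {u : Lit m} {u′ : Lit n} → lit u ≡ u′ →
                T (reach F u (neg u)) → T (reach (map clause F) u′ (neg u′))
  reach-image {F} {u} refl uū =
    Walks.walk-mono (map clause F) (ℕ.*-monoʳ-≤ 2 (Fin.injective⇒≤ ι-injective))
      (subst (λ z → T (walk≤ (map clause F) (2 ℕ.* m) (lit u) z)) (lit-neg u) (walk-image (2 ℕ.* m) uū))

module _ {n : ℕ} (u v : Lit n) where

  transposition : LitEmbedding n n
  transposition = record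
    { ι           = Perm.transpose (var u) (var v)
    ; ι-injective = λ {i} {j} eq → trans (sym (Perm.transpose-inverse (var v) (var u)))
                                     (trans (cong (Perm.transpose (var v) (var u)) eq) (Perm.transpose-inverse (var v) (var u)))
    ; flips       = λ i → ⌊ i Fin.≟ var u ⌋ ∧ (proj₂ u xor proj₂ v)
    }

  open LitEmbedding transposition using (lit)

  transposition-moves : lit u ≡ v
  transposition-moves with var u Fin.≟ var u
  ... | no u≢u = contradiction refl u≢u
  ... | yes _  = cong₂ _,_ refl (cancel (proj₂ u) (proj₂ v))
    where
    cancel : ∀ s t → (s xor t) xor s ≡ t
    cancel true  true  = refl
    cancel true  false = refl
    cancel false true  = refl
    cancel false false = refl

  transposition-fixes : (z : Lit n) → var z ≢ var u → var z ≢ var v → lit z ≡ z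
  transposition-fixes z z≢u z≢v with var z Fin.≟ var u
  ... | yes z≡u = contradiction z≡u z≢u
  ... | no _ with var z Fin.≟ var v
  ...   | yes z≡v = contradiction z≡v z≢v
  ...   | no _    = refl

-- Symmetry

module Symmetry (p : ℚ) (0≤p : 0ℚ ≤ p) (p≤1 : p ≤ 1ℚ) where
  open Expectation p
  open Monotonicity p 0≤p p≤1

  𝔼-transport : (e : LitEmbedding m n) {E : Formula m → Bool} {E′ : Formula n → Bool} {L : List (Clause n)} →
                Increasing E′ → (∀ {F} → T (E F) → T (E′ (map (LitEmbedding.clause e) F))) →
                map (LitEmbedding.clause e) (clauses m) ⊆ L → 𝔼 (clauses m) (𝟙 ∘ E) ≤ 𝔼 L (𝟙 ∘ E′)
  𝔼-transport {m} e {E} {E′} {L} inc E⇒E′ image⊆L = begin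
      𝔼 (clauses m) (𝟙 ∘ E)
    ≤⟨ 𝔼-mono (clauses m) (λ _ → 𝟙-mono E⇒E′) ⟩
      𝔼 (clauses m) (𝟙 ∘ E′ ∘ map clause)
    ≡⟨ sym (𝔼-map clause (clauses m) (𝟙 ∘ E′)) ⟩
      𝔼 (map clause (clauses m)) (𝟙 ∘ E′)
    ≤⟨ 𝔼-⊆ (𝟙-mono ∘ inc) image-unique image⊆L ⟩
      𝔼 L (𝟙 ∘ E′) ∎
    where
    open ≤-Reasoning
    open LitEmbedding e

  PrContra-invariant : (u v : Lit n) → PrContra n p u ≤ PrContra n p v
  PrContra-invariant {n} u v = begin
      PrContra n p u
    ≡⟨ Pr≡𝔼 n (λ F → contra F u) ⟩
      𝔼 (clauses n) (λ F → 𝟙 (contra F u))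
    ≤⟨ 𝔼-transport σ (reach-increasing v (neg v)) (reach-image (transposition-moves u v)) image-⊆ ⟩
      𝔼 (clauses n) (λ F → 𝟙 (contra F v))
    ≡⟨ sym (Pr≡𝔼 n (λ F → contra F v)) ⟩
      PrContra n p v ∎
    where
    open ≤-Reasoning
    σ : LitEmbedding n n
    σ = transposition u v
    open LitEmbedding σ

  PrContraM≤PrContra : ∀ m (u : Lit m) → PrContraM m p ≤ PrContra m p u
  PrContraM≤PrContra (suc m) u = PrContra-invariant (Fin.zero , true) u

  PrBoth-invariant : (x y y′ : Lit n) → var y ≢ var x → var y′ ≢ var x →
                     Pr n p (λ F → contra F x ∧ contra F y) ≤ Pr n p (λ F → contra F x ∧ contra F y′)
  PrBoth-invariant {n} x y y′ y≢x y′≢x = begin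
      Pr n p (λ F → contra F x ∧ contra F y)
    ≡⟨ Pr≡𝔼 n _ ⟩
      𝔼 (clauses n) (λ F → 𝟙 (contra F x ∧ contra F y))
    ≤⟨ 𝔼-transport σ (∧-increasing (reach-increasing x (neg x)) (reach-increasing y′ (neg y′))) both image-⊆ ⟩
      𝔼 (clauses n) (λ F → 𝟙 (contra F x ∧ contra F y′))
    ≡⟨ sym (Pr≡𝔼 n _) ⟩
      Pr n p (λ F → contra F x ∧ contra F y′) ∎
    where
    open ≤-Reasoning
    σ : LitEmbedding n n
    σ = transposition y y′
    open LitEmbedding σ
    both : ∀ {F} → T (contra F x ∧ contra F y) → T (contra (map clause F) x ∧ contra (map clause F) y′)
    both {F} xx̄∧yȳ with T-∧ {contra F x} .to xx̄∧yȳ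
    ... | xx̄ , yȳ = T-∧ .from ( reach-image (transposition-fixes y y′ x (y≢x ∘ sym) (y′≢x ∘ sym)) xx̄
                              , reach-image (transposition-moves y y′) yȳ)

-- Strictly distinct sets of literals

mentions : List (Lit n) → Fin n → Bool
mentions S i = any (λ l → ⌊ var l Fin.≟ i ⌋) S

mentions-∈ : {S : List (Lit n)} {u : Lit n} → u ∈ S → T (mentions S (var u))
mentions-∈ = any⁺ _ ∘ Any.map (λ { refl → fromWitness refl })

touches : List (Lit n) → Clause n → Bool
touches S (a , b) = mentions S (var a) ∨ mentions S (var b)

SD-cons⁻ : {l : Lit n} (S : List (Lit n)) → T (strictlyDistinctᴮ (l ∷ S)) →
           ¬ T (mentions S (var l)) × T (strictlyDistinctᴮ S)
SD-cons⁻ {l = l} S sd with T-∧ {all _ S} .to sd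
... | apart , sd-S = unmentioned , sd-S
  where
  unmentioned : ¬ T (mentions S (var l))
  unmentioned mentioned with find (any⁻ _ S mentioned)
  ... | m , m∈S , m~l with T-∧ {not (l == m)} .to (All.lookup (All.all⁺ _ S apart) m∈S) | same-var l m (toWitness m~l)
  ...   | l≠m , _   | inj₁ refl = T-not .to l≠m (==-refl l)
  ...   | _ , l≠m̄   | inj₂ refl = T-not .to l≠m̄ (subst (λ z → T (l == z)) (sym (neg-involutive l)) (==-refl l))

count-mentions : (S : List (Lit n)) → T (strictlyDistinctᴮ S) → count (mentions S) (allFin n) ≡ length S
count-mentions {n} []      _  = count-none {P = mentions []} {allFin n} (λ _ ())
count-mentions {n} (l ∷ S) sd with SD-cons⁻ S sd
... | unmentioned , sd-S = trans (count-∨ (allFin n) disjoint)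
    (cong₂ ℕ._+_ (count-≟ (var l) (Unique.allFin⁺ n) (∈-allFin (var l))) (count-mentions S sd-S))
  where
  disjoint : ∀ {i} → i ∈ allFin n → T ⌊ var l Fin.≟ i ⌋ → ¬ T (mentions S i)
  disjoint _ l~i with refl ← toWitness l~i = unmentioned

count-unmentioned : (S : List (Lit n)) → T (strictlyDistinctᴮ S) → count (not ∘ mentions S) (allFin n) ≡ n ∸ length S
count-unmentioned {n} S sd = begin
    count (not ∘ mentions S) (allFin n)
  ≡⟨ sym (ℕ.m+n∸n≡m _ (count (mentions S) (allFin n))) ⟩
    count (not ∘ mentions S) (allFin n) ℕ.+ count (mentions S) (allFin n) ∸ count (mentions S) (allFin n)
  ≡⟨ cong₂ _∸_ (trans (count-not (mentions S) (allFin n)) (length-allFin n)) (count-mentions S sd) ⟩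
    n ∸ length S ∎
  where open ≡-Reasoning

SD-length≤ : (S : List (Lit n)) → T (strictlyDistinctᴮ S) → length S ℕ.≤ n
SD-length≤ {n} S sd = subst₂ ℕ._≤_ (count-mentions S sd) (length-allFin n) (count≤length (mentions S) (allFin n))

SD-no-complement : (S : List (Lit n)) {l : Lit n} → T (strictlyDistinctᴮ S) → l ∈ S → ¬ (neg l ∈ S)
SD-no-complement (m ∷ S) sd (here refl) (here m̄≡m)  = not-¬ refl (sym (cong proj₂ m̄≡m))
SD-no-complement (m ∷ S) sd (here refl) (there m̄∈S) = proj₁ (SD-cons⁻ {l = m} S sd) (mentions-∈ m̄∈S)
SD-no-complement (m ∷ S) sd (there l∈S) (here l̄≡m)  =
  proj₁ (SD-cons⁻ {l = m} S sd) (subst (λ z → T (mentions S (var z))) l̄≡m (mentions-∈ l∈S))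
SD-no-complement (m ∷ S) sd (there l∈S) (there l̄∈S) = SD-no-complement S (proj₂ (SD-cons⁻ {l = m} S sd)) l∈S l̄∈S

SD-filter : (P : Lit n → Bool) {xs : List (Lit n)} → Unique xs → (∀ {l} → T (P l) → ¬ T (P (neg l))) →
            T (strictlyDistinctᴮ (filter (λ l → P l Bool.≟ true) xs))
SD-filter P {[]}     _                   _          = tt
SD-filter P {y ∷ ys} (y∉ys ∷ ys-unique) consistent with P y in Py
... | false = SD-filter P ys-unique consistent
... | true  = T-∧ .from (All.all⁻ _ (All.tabulate apart) , SD-filter P ys-unique consistent)
  where
  apart : ∀ {m} → m ∈ filter (λ l → P l Bool.≟ true) ys → T (not (y == m) ∧ not (y == neg m))
  apart {m} m∈ with ∈-filter⁻ (λ l → P l Bool.≟ true) {xs = ys} m∈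
  ... | m∈ys , Pm = T-∧ .from ( T-not .from (λ y=m → All.lookup y∉ys m∈ys (==⇒≡ y m y=m))
                              , T-not .from (λ y=m̄ → consistent (T-≡ .from Pm)
                                  (subst (T ∘ P) (==⇒≡ y (neg m) y=m̄) (T-≡ .from Py))))

module Avoidance (p : ℚ) (0≤p : 0ℚ ≤ p) (p≤1 : p ≤ 1ℚ) where
  open Expectation p
  open Monotonicity p 0≤p p≤1
  open Symmetry p 0≤p p≤1

  PrContraM-nonneg : ∀ m → 0ℚ ≤ PrContraM m p
  PrContraM-nonneg zero    = ≤-refl
  PrContraM-nonneg (suc m) = ≤-trans (𝔼-nonneg (clauses (suc m)) (λ F → 𝟙-nonneg (contra F x₀))) (≤-reflexive (sym (Pr≡𝔼 (suc m) _)))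
    where
    x₀ : Lit (suc m)
    x₀ = Fin.zero , true

  -- The variables not mentioned by S carry a copy of F_{n−|S|,p} made of clauses avoiding S.
  PrContraM≤avoiding : (S : List (Lit n)) (y : Lit n) → T (strictlyDistinctᴮ S) → ¬ T (mentions S (var y)) →
                       PrContraM (n ∸ length S) p ≤ 𝔼 (filterᵇ (not ∘ touches S) (clauses n)) (λ F → 𝟙 (contra F y))
  PrContraM≤avoiding {n} S y sd y-free = begin
      PrContraM (n ∸ length S) p
    ≡⟨ cong (λ j → PrContraM j p) (sym k≡n∸|S|) ⟩
      PrContraM k p
    ≤⟨ PrContraM≤PrContra k y₀ ⟩
      PrContra k p y₀
    ≡⟨ Pr≡𝔼 k (λ F → contra F y₀) ⟩
      𝔼 (clauses k) (λ F → 𝟙 (contra F y₀))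
    ≤⟨ 𝔼-transport e (reach-increasing y (neg y)) (reach-image lit-y₀) image-avoids ⟩
      𝔼 (filterᵇ (not ∘ touches S) (clauses n)) (λ F → 𝟙 (contra F y)) ∎
    where
    open ≤-Reasoning
    Z : List (Fin n)
    Z = filterᵇ (not ∘ mentions S) (allFin n)
    k : ℕ
    k = length Z
    k≡n∸|S| : k ≡ n ∸ length S
    k≡n∸|S| = trans (length-filterᵇ _ (allFin n)) (count-unmentioned S sd)
    e : LitEmbedding k n
    e = record { ι = lookup Z ; ι-injective = lookup-injective (Unique.filter⁺ _ (Unique.allFin⁺ n)) ; flips = λ _ → false }
    open LitEmbedding e
    y∈Z : var y ∈ Z
    y∈Z = ∈-filter⁺ (T? ∘ (not ∘ mentions S)) (∈-allFin (var y)) (T-not .from y-free)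
    y₀ : Lit k
    y₀ = Any.index y∈Z , proj₂ y
    lit-y₀ : lit y₀ ≡ y
    lit-y₀ = cong (_, proj₂ y) (sym (lookup-index y∈Z))
    lit-free : (l : Lit k) → ¬ T (mentions S (var (lit l)))
    lit-free (i , _) = T-not .to (proj₂ (∈-filter⁻ (T? ∘ (not ∘ mentions S)) {xs = allFin n} (∈-lookup i)))
    avoids : ∀ a b → ¬ T (touches S (orient (lit a) (lit b)))
    avoids a b touching with orient-cases (lit a) (lit b)
    ... | inj₁ eq = ⊎.[ lit-free a , lit-free b ] (T-∨ .to (subst (T ∘ touches S) eq touching))
    ... | inj₂ eq = ⊎.[ lit-free b , lit-free a ] (T-∨ .to (subst (T ∘ touches S) eq touching))
    image-avoids : map clause (clauses k) ⊆ filterᵇ (not ∘ touches S) (clauses n)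
    image-avoids c∈ with ∈-map⁻ clause c∈
    ... | (a , b) , c₀∈ , refl = ∈-filter⁺ (T? ∘ (not ∘ touches S)) (clause-∈ c₀∈) (T-not .from (avoids a b))

-- Conditioning on L⁺(x)

edge-touching : (S : List (Lit n)) (F : Formula n) {u w : Lit n} → u ∈ S →
                T (edge F u w) → T (edge (filterᵇ (touches S) F) u w)
edge-touching S F u∈S uw with hasClause⁻ F uw
... | inj₁ c∈F = hasClause⁺ _ (inj₁ (∈-filter⁺ (T? ∘ touches S) c∈F (T-∨ .from (inj₁ (mentions-∈ u∈S)))))
... | inj₂ c∈F = hasClause⁺ _ (inj₂ (∈-filter⁺ (T? ∘ touches S) c∈F (T-∨ .from (inj₂ (mentions-∈ u∈S)))))

reach-local : {x : Lit n} (S : List (Lit n)) (F : Formula n) →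
              (∀ {u} → T (reach (filterᵇ (touches S) F) x u) → u ∈ S) →
              ∀ l → reach F x l ≡ reach (filterᵇ (touches S) F) x l
reach-local {n} S F closed l =
  T-injective (walk-restrict (2 ℕ.* n) (λ xu → edge-touching S F (closed xu)))
              (walk-⊆ (filterᵇ-⊆ (touches S) F) (2 ℕ.* n))

-- L⁺(x) is encoded by its indicator vector over allLits, so that conditioning on its value
-- becomes a finite sum over bit vectors.
module Profile {n : ℕ} (x : Lit n) where

  profile : Formula n → List Bool
  profile F = map (reach F x) (allLits n)

  selected : List Bool → List (Lit n)
  selected b = select b (allLits n)

  hasProfile : List Bool → Formula n → Bool
  hasProfile b F = profile F ≡ᵇ b

  ∈-Lplus⁺ : {F : Formula n} {u : Lit n} → T (reach F x u) → u ∈ Lplus F x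
  ∈-Lplus⁺ {F} {u} xu = ∈-filter⁺ (λ l → reach F x l Bool.≟ true) (∈-allLits u) (T-≡ .to xu)

  x∈Lplus : (F : Formula n) → x ∈ Lplus F x
  x∈Lplus F = ∈-Lplus⁺ (Walks.walk-refl F (2 ℕ.* n))

  Lplus≡selected : {b : List Bool} {F : Formula n} → T (hasProfile b F) → Lplus F x ≡ selected b
  Lplus≡selected {b} {F} has-b = trans (filter≡select (reach F x) (allLits n)) (cong (λ b → select b (allLits n)) (≡ᵇ⇒≡ (profile F) b has-b))

  profile-local : {b : List Bool} {F : Formula n} → T (hasProfile b F) ⊎ T (hasProfile b (filterᵇ (touches (selected b)) F)) →
                  profile F ≡ profile (filterᵇ (touches (selected b)) F)
  profile-local {b} {F} has-b = map-cong-local (All.tabulate (λ {l} _ → reach-local (selected b) F closed l))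
    where
    G : Formula n
    G = filterᵇ (touches (selected b)) F
    closed : ∀ {u} → T (reach G x u) → u ∈ selected b
    closed xu = ⊎.[ (λ F-has-b → subst (_ ∈_) (Lplus≡selected F-has-b) (∈-Lplus⁺ (walk-⊆ (filterᵇ-⊆ _ F) (2 ℕ.* n) xu)))
                  , (λ G-has-b → subst (_ ∈_) (Lplus≡selected G-has-b) (∈-Lplus⁺ xu)) ] has-b

  reach-complement⇒contra : {F : Formula n} {l : Lit n} → T (reach F x l) → T (reach F x (neg l)) → T (contra F x)
  reach-complement⇒contra {F} {l} xl xl̄ = Saturation.reach-saturated F x (2 ℕ.* n ℕ.+ 2 ℕ.* n)
    (Walks.walk-++ F (2 ℕ.* n) (2 ℕ.* n) xl̄ (Walks.walk-dual F (2 ℕ.* n) xl))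

  SD⇒¬contra : (F : Formula n) → T (strictlyDistinctᴮ (Lplus F x)) → ¬ T (contra F x)
  SD⇒¬contra F sd xx̄ = SD-no-complement (Lplus F x) sd (x∈Lplus F) (∈-Lplus⁺ xx̄)

  ¬contra⇒SD : (F : Formula n) → ¬ T (contra F x) → T (strictlyDistinctᴮ (Lplus F x))
  ¬contra⇒SD F ¬xx̄ = SD-filter (reach F x) (allLits-unique n) (λ xl xl̄ → ¬xx̄ (reach-complement⇒contra xl xl̄))

module Conditioning (p : ℚ) (0≤p : 0ℚ ≤ p) (p≤1 : p ≤ 1ℚ) {n : ℕ} (x : Lit n) where
  open Expectation p
  open Monotonicity p 0≤p p≤1
  open Avoidance p 0≤p p≤1
  open Profile x

  private
    C : List (Clause n)
    C = clauses n

  profile-inside : (b : List Bool) → 𝔼 C (𝟙 ∘ hasProfile b) ≤ 𝔼 (filterᵇ (touches (selected b)) C) (𝟙 ∘ hasProfile b)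
  profile-inside b = begin
      𝔼 C (𝟙 ∘ hasProfile b)
    ≤⟨ 𝔼-mono C (λ F → ≤-trans (𝟙-mono (localise F)) (≤-reflexive (sym (ℚ.*-identityʳ (𝟙 (hasProfile b (filterᵇ P F))))))) ⟩
      𝔼 C (λ F → 𝟙 (hasProfile b (filterᵇ P F)) * 1ℚ)
    ≡⟨ 𝔼-filter-independent P C (𝟙 ∘ hasProfile b) (λ _ → 1ℚ) ⟩
      𝔼 (filterᵇ P C) (𝟙 ∘ hasProfile b) * 𝔼 (filterᵇ (not ∘ P) C) (λ _ → 1ℚ)
    ≡⟨ trans (cong (inside *_) (𝔼-const (filterᵇ (not ∘ P) C) 1ℚ)) (ℚ.*-identityʳ inside) ⟩
      𝔼 (filterᵇ P C) (𝟙 ∘ hasProfile b) ∎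
    where
    open ≤-Reasoning
    P : Clause n → Bool
    P = touches (selected b)
    inside : ℚ
    inside = 𝔼 (filterᵇ P C) (𝟙 ∘ hasProfile b)
    localise : ∀ F → T (hasProfile b F) → T (hasProfile b (filterᵇ P F))
    localise F has-b = subst (λ π → T (π ≡ᵇ b)) (profile-local (inj₁ has-b)) has-b

  -- The event L⁺(x) = S is read off the clauses touching S, and y ⇝ ȳ is witnessed by the clauses
  -- avoiding S; these two sets of clauses are independent.
  profile-contra-lower : (b : List Bool) (y : Lit n) → T (strictlyDistinctᴮ (selected b)) →
                         ¬ T (mentions (selected b) (var y)) →
                         𝔼 C (𝟙 ∘ hasProfile b) * PrContraM (n ∸ length (selected b)) p
                           ≤ 𝔼 C (λ F → 𝟙 (hasProfile b F ∧ contra F y))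
  profile-contra-lower b y sd y-free = begin
      𝔼 C (𝟙 ∘ hasProfile b) * M
    ≤⟨ ℚ.*-monoʳ-≤-nonNeg M {{nonNegative (PrContraM-nonneg (n ∸ length S))}} (profile-inside b) ⟩
      inside * M
    ≤⟨ ℚ.*-monoˡ-≤-nonNeg inside {{nonNegative (𝔼-nonneg (filterᵇ P C) (𝟙-nonneg ∘ hasProfile b))}} (PrContraM≤avoiding S y sd y-free) ⟩
      𝔼 (filterᵇ P C) (𝟙 ∘ hasProfile b) * 𝔼 (filterᵇ (not ∘ P) C) (λ F → 𝟙 (contra F y))
    ≡⟨ sym (𝔼-filter-independent P C (𝟙 ∘ hasProfile b) (λ F → 𝟙 (contra F y))) ⟩
      𝔼 C (λ F → 𝟙 (hasProfile b (filterᵇ P F)) * 𝟙 (contra (filterᵇ (not ∘ P) F) y))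
    ≤⟨ 𝔼-mono C (λ F → ≤-trans (≤-reflexive (𝟙-∧ (hasProfile b (filterᵇ P F)) (contra (filterᵇ (not ∘ P) F) y))) (𝟙-mono (globalise F))) ⟩
      𝔼 C (λ F → 𝟙 (hasProfile b F ∧ contra F y)) ∎
    where
    open ≤-Reasoning
    S : List (Lit n)
    S = selected b
    P : Clause n → Bool
    P = touches S
    M : ℚ
    M = PrContraM (n ∸ length S) p
    inside : ℚ
    inside = 𝔼 (filterᵇ P C) (𝟙 ∘ hasProfile b)
    globalise : ∀ F → T (hasProfile b (filterᵇ P F) ∧ contra (filterᵇ (not ∘ P) F) y) → T (hasProfile b F ∧ contra F y)
    globalise F both with T-∧ {hasProfile b (filterᵇ P F)} .to both
    ... | has-b , yȳ = T-∧ .from ( subst (λ π → T (π ≡ᵇ b)) (sym (profile-local (inj₂ has-b))) has-b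
                                 , reach-increasing y (neg y) (filterᵇ-⊆ (not ∘ P) F) yȳ)

module Correlation (p : ℚ) (0≤p : 0ℚ ≤ p) (p≤1 : p ≤ 1ℚ) {n : ℕ} (x : Lit n) where
  open Expectation p
  open Monotonicity p 0≤p p≤1
  open Symmetry p 0≤p p≤1
  open Avoidance p 0≤p p≤1
  open Conditioning p 0≤p p≤1 x
  open Profile x

  C : List (Clause n)
  C = clauses n

  Pxx̄ : ℚ
  Pxx̄ = PrContra n p x

  SD : Formula n → Bool
  SD F = strictlyDistinctᴮ (Lplus F x)

  PrSD : ℚ
  PrSD = 𝔼 C (𝟙 ∘ SD)

  Pxx̄-nonneg : 0ℚ ≤ Pxx̄
  Pxx̄-nonneg = ≤-trans (𝔼-nonneg C (λ F → 𝟙-nonneg (contra F x))) (≤-reflexive (sym (Pr≡𝔼 n (λ F → contra F x))))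

  W : ℚ
  W = 𝔼 C (λ F → 𝟙 (SD F) * (ratio (n ∸ length (Lplus F x)) (n ∸ 1) * PrContraM (n ∸ length (Lplus F x)) p))

  sumFrom1-Pnp : (g : ℕ → ℚ) → sumFrom1 n (λ k → Pnp n p x k * g k) ≡ 𝔼 C (λ F → 𝟙 (SD F) * g (length (Lplus F x)))
  sumFrom1-Pnp g = begin
      sumFrom1 n (λ k → Pnp n p x k * g k)
    ≡⟨ sumFrom1-cong n (λ k → trans (cong (_* g k) (Pr≡𝔼 n _)) (sym (𝔼-*ʳ C (g k) _))) ⟩
      sumFrom1 n (λ k → 𝔼 C (λ F → 𝟙 (SD F ∧ (length (Lplus F x) ℕ.≡ᵇ k)) * g k))
    ≡⟨ sym (𝔼-sumFrom1 C n _) ⟩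
      𝔼 C (λ F → sumFrom1 n (λ k → 𝟙 (SD F ∧ (length (Lplus F x) ℕ.≡ᵇ k)) * g k))
    ≡⟨ 𝔼-cong C (λ F → pick F (SD F) refl) ⟩
      𝔼 C (λ F → 𝟙 (SD F) * g (length (Lplus F x))) ∎
    where
    open ≡-Reasoning
    pick : ∀ F s → SD F ≡ s → sumFrom1 n (λ k → 𝟙 (s ∧ (length (Lplus F x) ℕ.≡ᵇ k)) * g k) ≡ 𝟙 s * g (length (Lplus F x))
    pick F true  sd = trans (sumFrom1-delta n g (∈⇒1≤length (x∈Lplus F)) (SD-length≤ (Lplus F x) (T-≡ .from sd)))
                            (sym (ℚ.*-identityˡ _))
    pick F false _  = trans (sumFrom1-zero n (λ {k} _ → ℚ.*-zeroˡ (g k))) (sym (ℚ.*-zeroˡ (g (length (Lplus F x)))))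

  rhs+W≡Pxx̄*PrSD : sumFrom1 n (λ k → Pnp n p x k * (Pxx̄ - ratio (n ∸ k) (n ∸ 1) * PrContraM (n ∸ k) p)) + W ≡ Pxx̄ * PrSD
  rhs+W≡Pxx̄*PrSD = begin
      sumFrom1 n (λ k → Pnp n p x k * (Pxx̄ - r k)) + W
    ≡⟨ cong (_+ W) (sumFrom1-Pnp (λ k → Pxx̄ - r k)) ⟩
      𝔼 C (λ F → 𝟙 (SD F) * (Pxx̄ - r (size F))) + W
    ≡⟨ sym (𝔼-+ C _ _) ⟩
      𝔼 C (λ F → 𝟙 (SD F) * (Pxx̄ - r (size F)) + 𝟙 (SD F) * r (size F))
    ≡⟨ 𝔼-cong C (λ F → cancel (𝟙 (SD F)) Pxx̄ (r (size F))) ⟩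
      𝔼 C (λ F → Pxx̄ * 𝟙 (SD F))
    ≡⟨ 𝔼-*ˡ C Pxx̄ (𝟙 ∘ SD) ⟩
      Pxx̄ * PrSD ∎
    where
    open ≡-Reasoning
    size : Formula n → ℕ
    size F = length (Lplus F x)
    r : ℕ → ℚ
    r k = ratio (n ∸ k) (n ∸ 1) * PrContraM (n ∸ k) p
    cancel : ∀ i a b → i * (a - b) + i * b ≡ a * i
    cancel = solve 3 (λ i a b → i :* (a :- b) :+ i :* b := a :* i) refl

  1-Pxx̄≤PrSD : 1ℚ - Pxx̄ ≤ PrSD
  1-Pxx̄≤PrSD = begin
      1ℚ - Pxx̄
    ≡⟨ cong (_- Pxx̄) (sym total) ⟩
      (𝔼 C (λ F → 𝟙 (not (contra F x))) + Pxx̄) - Pxx̄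
    ≡⟨ solve 2 (λ u a → (u :+ a) :- a := u) refl (𝔼 C (λ F → 𝟙 (not (contra F x)))) Pxx̄ ⟩
      𝔼 C (λ F → 𝟙 (not (contra F x)))
    ≤⟨ 𝔼-mono C (λ F → 𝟙-mono (¬contra⇒SD F ∘ T-not .to)) ⟩
      PrSD ∎
    where
    open ≤-Reasoning
    𝟙-not : ∀ b → 𝟙 (not b) + 𝟙 b ≡ 1ℚ
    𝟙-not true  = ℚ.+-identityˡ 1ℚ
    𝟙-not false = ℚ.+-identityʳ 1ℚ
    total : 𝔼 C (λ F → 𝟙 (not (contra F x))) + Pxx̄ ≡ 1ℚ
    total = begin-equality
        𝔼 C (λ F → 𝟙 (not (contra F x))) + Pxx̄
      ≡⟨ cong (𝔼 C (λ F → 𝟙 (not (contra F x))) +_) (Pr≡𝔼 n (λ F → contra F x)) ⟩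
        𝔼 C (λ F → 𝟙 (not (contra F x))) + 𝔼 C (λ F → 𝟙 (contra F x))
      ≡⟨ sym (𝔼-+ C _ _) ⟩
        𝔼 C (λ F → 𝟙 (not (contra F x)) + 𝟙 (contra F x))
      ≡⟨ trans (𝔼-cong C (λ F → 𝟙-not (contra F x))) (𝔼-const C 1ℚ) ⟩
        1ℚ ∎

  PrBoth : Lit n → ℚ
  PrBoth y = Pr n p (λ F → contra F x ∧ contra F y)

  PrOnly : Lit n → ℚ
  PrOnly y = 𝔼 C (λ F → 𝟙 (contra F y ∧ not (contra F x)))

  other : Lit n → Bool
  other y = not (mentions [ x ] (var y))

  free : List (Lit n) → Lit n → Bool
  free S y = other y ∧ (strictlyDistinctᴮ S ∧ not (mentions S (var y)))

  mentions-[x] : ∀ {i} → T (mentions [ x ] i) → var x ≡ i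
  mentions-[x] {i} x~i with any⁻ (λ l → ⌊ var l Fin.≟ i ⌋) [ x ] x~i
  ... | here x≡i = toWitness {a? = var x Fin.≟ i} x≡i

  other⇒var≢ : ∀ {y} → T (other y) → var y ≢ var x
  other⇒var≢ o y≡x = T-not .to o (subst (T ∘ mentions [ x ]) (sym y≡x) (mentions-∈ {S = [ x ]} (here refl)))

  count-other : count other (allLits n) ≡ 2 ℕ.* (n ∸ 1)
  count-other = trans (count-vars (not ∘ mentions [ x ])) (cong (2 ℕ.*_) (count-unmentioned [ x ] tt))

  count-free : (S : List (Lit n)) → T (strictlyDistinctᴮ S) → T (mentions S (var x)) →
               count (free S) (allLits n) ≡ 2 ℕ.* (n ∸ length S)
  count-free S sd x∈S =
    trans (count-cong (allLits n) same) (trans (count-vars (not ∘ mentions S)) (cong (2 ℕ.*_) (count-unmentioned S sd)))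
    where
    same : ∀ y → free S y ≡ not (mentions S (var y))
    same y = T-injective (λ f → proj₂ (T-∧ .to (proj₂ (T-∧ {other y} .to f))))
      (λ y∉S → T-∧ .from (T-not .from (λ x~y → T-not .to y∉S (subst (T ∘ mentions S) (mentions-[x] x~y) x∈S)) , T-∧ .from (sd , y∉S)))

  Φ : List (Lit n) → Formula n → ℚ
  Φ S F = sumℚ (map (λ y → 𝟙 (free S y) * 𝟙 (contra F y)) (allLits n))

  𝔼Φ≤ΣPrOnly : 𝔼 C (λ F → Φ (Lplus F x) F) ≤ sumℚ (map (λ y → 𝟙 (other y) * PrOnly y) (allLits n))
  𝔼Φ≤ΣPrOnly = begin
      𝔼 C (λ F → Φ (Lplus F x) F)
    ≡⟨ 𝔼-sumℚ C (allLits n) _ ⟩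
      sumℚ (map (λ y → 𝔼 C (λ F → 𝟙 (free (Lplus F x) y) * 𝟙 (contra F y))) (allLits n))
    ≤⟨ sumℚ-mono (allLits n) (λ y → ≤-trans (𝔼-mono C (bound y)) (≤-reflexive (𝔼-*ˡ C (𝟙 (other y)) _))) ⟩
      sumℚ (map (λ y → 𝟙 (other y) * PrOnly y) (allLits n)) ∎
    where
    open ≤-Reasoning
    bound : ∀ y F → 𝟙 (free (Lplus F x) y) * 𝟙 (contra F y) ≤ 𝟙 (other y) * 𝟙 (contra F y ∧ not (contra F x))
    bound y F = subst₂ _≤_ (sym (𝟙-∧ (free (Lplus F x) y) _)) (sym (𝟙-∧ (other y) _)) (𝟙-mono implied)
      where
      implied : T (free (Lplus F x) y ∧ contra F y) → T (other y ∧ (contra F y ∧ not (contra F x)))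
      implied h with T-∧ {free (Lplus F x) y} .to h
      ... | f , yȳ with T-∧ {other y} .to f
      ...   | o , sd∧free = T-∧ .from (o , T-∧ .from (yȳ , T-not .from (SD⇒¬contra F (proj₁ (T-∧ .to sd∧free)))))

  ψ : List (Lit n) → ℚ
  ψ S = 𝟙 (strictlyDistinctᴮ S ∧ mentions S (var x)) * (fromℕ (2 ℕ.* (n ∸ length S)) * PrContraM (n ∸ length S) p)

  profile-term≤ : (b : List Bool) → 𝔼 C (λ F → 𝟙 (hasProfile b F) * ψ (selected b)) ≤ 𝔼 C (λ F → 𝟙 (hasProfile b F) * Φ (selected b) F)
  profile-term≤ b = begin
      𝔼 C (λ F → 𝟙 (hasProfile b F) * ψ S)
    ≡⟨ 𝔼-*ʳ C (ψ S) (𝟙 ∘ hasProfile b) ⟩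
      Eb * ψ S
    ≡⟨ reorder Eb (𝟙 ok) (fromℕ (2 ℕ.* (n ∸ length S))) M ⟩
      𝟙 ok * (fromℕ (2 ℕ.* (n ∸ length S)) * (Eb * M))
    ≤⟨ 𝟙*-≤ ok (sumℚ-nonneg (allLits n) (λ y → 𝟙*-nonneg (free S y) (𝔼-nonneg C (λ F → 𝟙*-nonneg (hasProfile b F) (𝟙-nonneg (contra F y)))))) main ⟩
      sumℚ (map (λ y → 𝟙 (free S y) * 𝔼 C (λ F → 𝟙 (hasProfile b F) * 𝟙 (contra F y))) (allLits n))
    ≡⟨ sym (𝔼-*-sumℚ C (allLits n) (𝟙 ∘ hasProfile b) (𝟙 ∘ free S) (λ y F → 𝟙 (contra F y))) ⟩
      𝔼 C (λ F → 𝟙 (hasProfile b F) * Φ S F) ∎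
    where
    open ≤-Reasoning
    S : List (Lit n)
    S = selected b
    ok : Bool
    ok = strictlyDistinctᴮ S ∧ mentions S (var x)
    M Eb : ℚ
    M = PrContraM (n ∸ length S) p
    Eb = 𝔼 C (𝟙 ∘ hasProfile b)
    reorder : ∀ e i k m → e * (i * (k * m)) ≡ i * (k * (e * m))
    reorder = solve 4 (λ e i k m → e :* (i :* (k :* m)) := i :* (k :* (e :* m))) refl
    main : T ok → fromℕ (2 ℕ.* (n ∸ length S)) * (Eb * M)
                  ≤ sumℚ (map (λ y → 𝟙 (free S y) * 𝔼 C (λ F → 𝟙 (hasProfile b F) * 𝟙 (contra F y))) (allLits n))
    main sd∧x∈S with T-∧ {strictlyDistinctᴮ S} .to sd∧x∈S
    ... | sd , x∈S = begin
        fromℕ (2 ℕ.* (n ∸ length S)) * (Eb * M)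
      ≡⟨ cong (λ k → fromℕ k * (Eb * M)) (sym (count-free S sd x∈S)) ⟩
        fromℕ (count (free S) (allLits n)) * (Eb * M)
      ≡⟨ sym (sumℚ-𝟙* (free S) (Eb * M) (allLits n)) ⟩
        sumℚ (map (λ y → 𝟙 (free S y) * (Eb * M)) (allLits n))
      ≤⟨ sumℚ-mono (allLits n) (λ y → 𝟙*-mono (free S y) (lower y)) ⟩
        sumℚ (map (λ y → 𝟙 (free S y) * 𝔼 C (λ F → 𝟙 (hasProfile b F) * 𝟙 (contra F y))) (allLits n)) ∎
      where
      lower : ∀ y → T (free S y) → Eb * M ≤ 𝔼 C (λ F → 𝟙 (hasProfile b F) * 𝟙 (contra F y))
      lower y f = ≤-trans (profile-contra-lower b y sd (T-not .to (proj₂ (T-∧ .to (proj₂ (T-∧ {other y} .to f))))))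
                          (≤-reflexive (𝔼-cong C (λ F → sym (𝟙-∧ (hasProfile b F) (contra F y)))))

  NW≡𝔼ψ : ∀ {d} → n ∸ 1 ≡ suc d → fromℕ (2 ℕ.* (n ∸ 1)) * W ≡ 𝔼 C (λ F → ψ (selected (profile F)))
  NW≡𝔼ψ n-1≡ = trans (sym (𝔼-*ˡ C (fromℕ (2 ℕ.* (n ∸ 1))) _)) (𝔼-cong C (λ F → trans (rescale F) (sym (ψ-profile F))))
    where
    size = λ F → length (Lplus F x)
    rescale : ∀ F → fromℕ (2 ℕ.* (n ∸ 1)) * (𝟙 (SD F) * (ratio (n ∸ size F) (n ∸ 1) * PrContraM (n ∸ size F) p))
                    ≡ 𝟙 (SD F) * (fromℕ (2 ℕ.* (n ∸ size F)) * PrContraM (n ∸ size F) p)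
    rescale F = fromℕ-double*ratio n-1≡ (n ∸ size F) (𝟙 (SD F)) (PrContraM (n ∸ size F) p)
    ψ-profile : ∀ F → ψ (selected (profile F))
                      ≡ 𝟙 (SD F) * (fromℕ (2 ℕ.* (n ∸ length (Lplus F x))) * PrContraM (n ∸ length (Lplus F x)) p)
    ψ-profile F = trans (cong ψ (sym (Lplus≡selected {profile F} (≡ᵇ-refl (profile F)))))
                        (cong (λ b → 𝟙 b * (fromℕ (2 ℕ.* (n ∸ length (Lplus F x))) * PrContraM (n ∸ length (Lplus F x)) p))
                              (trans (cong (SD F ∧_) (T-≡ .to (mentions-∈ (x∈Lplus F)))) (∧-identityʳ (SD F))))

  NW≤ΣPrOnly : ∀ {d} → n ∸ 1 ≡ suc d → fromℕ (2 ℕ.* (n ∸ 1)) * W ≤ sumℚ (map (λ y → 𝟙 (other y) * PrOnly y) (allLits n))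
  NW≤ΣPrOnly n-1≡ = begin
      fromℕ (2 ℕ.* (n ∸ 1)) * W
    ≡⟨ NW≡𝔼ψ n-1≡ ⟩
      𝔼 C (λ F → ψ (selected (profile F)))
    ≡⟨ 𝔼-by-key C N profile length-profile (λ b _ → ψ (selected b)) ⟩
      sumℚ (map (λ b → 𝔼 C (λ F → 𝟙 (hasProfile b F) * ψ (selected b))) (bitVectors N))
    ≤⟨ sumℚ-mono (bitVectors N) profile-term≤ ⟩
      sumℚ (map (λ b → 𝔼 C (λ F → 𝟙 (hasProfile b F) * Φ (selected b) F)) (bitVectors N))
    ≡⟨ sym (𝔼-by-key C N profile length-profile (λ b F → Φ (selected b) F)) ⟩
      𝔼 C (λ F → Φ (selected (profile F)) F)
    ≡⟨ 𝔼-cong C (λ F → cong (λ S → Φ S F) (sym (Lplus≡selected {profile F} (≡ᵇ-refl (profile F))))) ⟩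
      𝔼 C (λ F → Φ (Lplus F x) F)
    ≤⟨ 𝔼Φ≤ΣPrOnly ⟩
      sumℚ (map (λ y → 𝟙 (other y) * PrOnly y) (allLits n)) ∎
    where
    open ≤-Reasoning
    N : ℕ
    N = length (allLits n)
    length-profile : ∀ F → length (profile F) ≡ N
    length-profile F = length-map (reach F x) (allLits n)

  PrBoth+PrOnly : (y : Lit n) → PrBoth y + PrOnly y ≡ PrContra n p y
  PrBoth+PrOnly y = begin
      PrBoth y + PrOnly y
    ≡⟨ cong (_+ PrOnly y) (Pr≡𝔼 n _) ⟩
      𝔼 C (λ F → 𝟙 (contra F x ∧ contra F y)) + PrOnly y
    ≡⟨ sym (𝔼-+ C _ _) ⟩
      𝔼 C (λ F → 𝟙 (contra F x ∧ contra F y) + 𝟙 (contra F y ∧ not (contra F x)))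
    ≡⟨ 𝔼-cong C (λ F → split (contra F x) (contra F y)) ⟩
      𝔼 C (λ F → 𝟙 (contra F y))
    ≡⟨ sym (Pr≡𝔼 n _) ⟩
      PrContra n p y ∎
    where
    open ≡-Reasoning
    split : ∀ a b → 𝟙 (a ∧ b) + 𝟙 (b ∧ not a) ≡ 𝟙 b
    split true  true  = ℚ.+-identityʳ 1ℚ
    split true  false = ℚ.+-identityʳ 0ℚ
    split false true  = ℚ.+-identityˡ 1ℚ
    split false false = ℚ.+-identityʳ 0ℚ

  ΣPrOnly-bound : (y : Lit n) → var y ≢ var x →
    fromℕ (count other (allLits n)) * PrBoth y + sumℚ (map (λ y′ → 𝟙 (other y′) * PrOnly y′) (allLits n))
      ≤ fromℕ (count other (allLits n)) * Pxx̄
  ΣPrOnly-bound y y≢x = begin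
      fromℕ (count other Lits) * PrBoth y + sumℚ (map (λ y′ → 𝟙 (other y′) * PrOnly y′) Lits)
    ≡⟨ cong (_+ _) (sym (sumℚ-𝟙* other (PrBoth y) Lits)) ⟩
      sumℚ (map (λ y′ → 𝟙 (other y′) * PrBoth y) Lits) + sumℚ (map (λ y′ → 𝟙 (other y′) * PrOnly y′) Lits)
    ≡⟨ sym (sumℚ-+ _ _ Lits) ⟩
      sumℚ (map (λ y′ → 𝟙 (other y′) * PrBoth y + 𝟙 (other y′) * PrOnly y′) Lits)
    ≤⟨ sumℚ-mono Lits (λ y′ → ≤-trans (≤-reflexive (sym (ℚ.*-distribˡ-+ (𝟙 (other y′)) _ _))) (𝟙*-mono (other y′) (bound y′))) ⟩
      sumℚ (map (λ y′ → 𝟙 (other y′) * Pxx̄) Lits)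
    ≡⟨ sumℚ-𝟙* other Pxx̄ Lits ⟩
      fromℕ (count other Lits) * Pxx̄ ∎
    where
    open ≤-Reasoning
    Lits = allLits n
    bound : ∀ y′ → T (other y′) → PrBoth y + PrOnly y′ ≤ Pxx̄
    bound y′ o = begin
        PrBoth y + PrOnly y′
      ≤⟨ ℚ.+-monoˡ-≤ (PrOnly y′) (PrBoth-invariant x y y′ y≢x (other⇒var≢ {y′} o)) ⟩
        PrBoth y′ + PrOnly y′
      ≡⟨ PrBoth+PrOnly y′ ⟩
        PrContra n p y′
      ≤⟨ PrContra-invariant y′ x ⟩
        Pxx̄ ∎

  PrBoth+W≤Pxx̄ : ∀ {d} → n ∸ 1 ≡ suc d → (y : Lit n) → var y ≢ var x → PrBoth y + W ≤ Pxx̄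
  PrBoth+W≤Pxx̄ {d} n-1≡ y y≢x = ℚ.*-cancelˡ-≤-pos N {{positive N-positive}} (begin
      N * (PrBoth y + W)
    ≡⟨ ℚ.*-distribˡ-+ N (PrBoth y) W ⟩
      N * PrBoth y + N * W
    ≤⟨ ℚ.+-monoʳ-≤ (N * PrBoth y) (NW≤ΣPrOnly n-1≡) ⟩
      N * PrBoth y + ΣPrOnly
    ≤⟨ subst (λ k → fromℕ k * PrBoth y + ΣPrOnly ≤ fromℕ k * Pxx̄) count-other (ΣPrOnly-bound y y≢x) ⟩
      N * Pxx̄ ∎)
    where
    open ≤-Reasoning
    N ΣPrOnly : ℚ
    N = fromℕ (2 ℕ.* (n ∸ 1))
    ΣPrOnly = sumℚ (map (λ y′ → 𝟙 (other y′) * PrOnly y′) (allLits n))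
    N-positive : 0ℚ < N
    N-positive rewrite n-1≡ = fromℕ-positive (d ℕ.+ suc (d ℕ.+ 0))

StrictlyDistinct⇒var≢ : {x y : Lit n} → StrictlyDistinct x y → var y ≢ var x
StrictlyDistinct⇒var≢ {x = x} {y} (x≢y , x≢ȳ) y~x with same-var x y y~x
... | inj₁ y≡x  = x≢y (sym y≡x)
... | inj₂ y≡x̄ = x≢ȳ (trans (sym (neg-involutive x)) (cong neg (sym y≡x̄)))

var≢⇒n∸1≡suc : {x y : Lit n} → var y ≢ var x → ∃[ d ] n ∸ 1 ≡ suc d
var≢⇒n∸1≡suc {suc zero}    {Fin.zero , _} {Fin.zero , _} y≢x = contradiction refl y≢x
var≢⇒n∸1≡suc {suc (suc d)}                                _   = d , refl

lemma7p1 : (n : ℕ) (x y : Lit n) → StrictlyDistinct x y →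
           (p : ℚ) → 0ℚ < p → p < 1ℚ →
           Pr n p (λ F → reach F x (neg x) ∧ reach F y (neg y)) - (PrContra n p x * PrContra n p x)
             ≤ sumFrom1 n (λ k → Pnp n p x k * (PrContra n p x - ratio (n ∸ k) (n ∸ 1) * PrContraM (n ∸ k) p))
lemma7p1 n x y x≠y p 0<p p<1 with var≢⇒n∸1≡suc {x = x} {y} (StrictlyDistinct⇒var≢ x≠y)
... | d , n-1≡ = begin
    PrBoth y - Pxx̄ * Pxx̄
  ≤⟨ ℚ.+-monoˡ-≤ (- (Pxx̄ * Pxx̄)) PrBoth≤Pxx̄-W ⟩
    (Pxx̄ - W) - Pxx̄ * Pxx̄
  ≡⟨ solve 2 (λ a w → (a :- w) :- a :* a := a :* (con 1ℚ :- a) :- w) refl Pxx̄ W ⟩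
    Pxx̄ * (1ℚ - Pxx̄) - W
  ≤⟨ ℚ.+-monoˡ-≤ (- W) (ℚ.*-monoˡ-≤-nonNeg Pxx̄ {{nonNegative Pxx̄-nonneg}} 1-Pxx̄≤PrSD) ⟩
    Pxx̄ * PrSD - W
  ≡⟨ cong (_- W) (sym rhs+W≡Pxx̄*PrSD) ⟩
    (rhs + W) - W
  ≡⟨ +-cancel rhs W ⟩
    rhs ∎
  where
  open Correlation p (ℚ.<⇒≤ 0<p) (ℚ.<⇒≤ p<1) x
  open ≤-Reasoning
  rhs : ℚ
  rhs = sumFrom1 n (λ k → Pnp n p x k * (Pxx̄ - ratio (n ∸ k) (n ∸ 1) * PrContraM (n ∸ k) p))
  +-cancel : ∀ u w → (u + w) - w ≡ u
  +-cancel = solve 2 (λ u w → (u :+ w) :- w := u) refl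
  PrBoth≤Pxx̄-W : PrBoth y ≤ Pxx̄ - W
  PrBoth≤Pxx̄-W = ≤-trans (≤-reflexive (sym (+-cancel (PrBoth y) W)))
                          (ℚ.+-monoˡ-≤ (- W) (PrBoth+W≤Pxx̄ n-1≡ y (StrictlyDistinct⇒var≢ x≠y)))
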